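{- In the field $\mathbb{Q}((t^{ -1}))$, the equation $3x^3-3tx^2-9x+t=0$ has a unique solution $x$ with $\deg x>0$, and this $x$ has the continued fraction expansion with $\beta_0=1$, $a_0=t$ and, for all $i\ge 1$, $$\beta_i=(3i-1)(3i+1),\qquad a_i=(2i+1)t.$$
   Context: $\mathbb{Q}((t^{ -1}))$ is the field of formal Laurent series $\sum_{k\ge -d}c_kt^{ -k}$, $c_k\in\mathbb{Q}$; the degree of a nonzero series is the largest $d$ with $c_{ -d}\ne0$. Given nonzero rationals $\beta_0,\beta_1,\dots$ and polynomials $a_0,a_1,\dots\in\mathbb{Q}[t]$ with $\deg a_i\ge 1$ for $i\ge1$, a series $x$ is said to have the continued fraction expansion $\frac{1}{\beta_0}\Big(a_0+\cfrac{\beta_1}{a_1+\cfrac{\beta_2}{a_2+\cdots}}\Big)$ if, setting $x_0=x$ and $x_{i+1}=1/(\beta_ix_i-a_i)$, for every $i\ge0$ one has $\beta_ix_i-a_i\ne0$ and $\deg(\beta_ix_i-a_i)<0$ (i.e. $a_i/\beta_i$ is the polynomial part of $x_i$). -}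

module Defs where

open import Data.Nat as ℕ using (ℕ; zero; suc; _⊔_)
open import Data.Integer as ℤ using (ℤ; +_; -[1+_])
open import Data.Rational as ℚ using (ℚ; 0ℚ; 1ℚ)
open import Data.List using (List; map; foldr; upTo)
open import Data.Product using (Σ; ∃; _×_)
open import Relation.Binary.PropositionalEquality using (_≡_; _≢_)

-- The record (top , cf) represents
--   Σ_{j ≥ 0} cf j · t^(top - j),
-- so every element of ℚ((t⁻¹)) has (many) representations; equality is the
-- setoid relation _≈_ below (equality of all coefficients).
record Laurent : Set where
  constructor mkL
  field
    top : ℕ
    cf  : ℕ → ℚ
open Laurent public

coeff : Laurent → ℤ → ℚ
coeff x e with (+ top x) ℤ.- e
... | + j      = cf x j
... | -[1+ _ ] = 0ℚ

infix 4 _≈_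
_≈_ : Laurent → Laurent → Set
x ≈ y = ∀ (e : ℤ) → coeff x e ≡ coeff y e

const : ℚ → Laurent
const q = mkL 0 (λ { zero → q ; (suc _) → 0ℚ })

0L 1L tL : Laurent
0L = const 0ℚ
1L = const 1ℚ
tL = mkL 1 (λ { zero → 1ℚ ; (suc _) → 0ℚ })

infixl 6 _+L_ _-L_
infixl 7 _*L_ _•_

_+L_ : Laurent → Laurent → Laurent
x +L y = mkL d (λ j → coeff x (+ d ℤ.- + j) ℚ.+ coeff y (+ d ℤ.- + j))
  where d = top x ⊔ top y

_•_ : ℚ → Laurent → Laurent
q • x = mkL (top x) (λ j → q ℚ.* cf x j)

-L_ : Laurent → Laurent
-L x = (ℚ.- 1ℚ) • x

_-L_ : Laurent → Laurent → Laurent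
x -L y = x +L (-L y)

sumℚ : List ℚ → ℚ
sumℚ = foldr ℚ._+_ 0ℚ

_*L_ : Laurent → Laurent → Laurent
x *L y = mkL (top x ℕ.+ top y)
  (λ n → sumℚ (map (λ i → cf x i ℚ.* cf y (n ℕ.∸ i)) (upTo (suc n))))

HasDegree : Laurent → ℤ → Set
HasDegree x n = (coeff x n ≢ 0ℚ) × (∀ e → n ℤ.< e → coeff x e ≡ 0ℚ)

DegPos : Laurent → Set
DegPos x = ∃ λ n → HasDegree x n × (+ 0 ℤ.< n)

DegNeg : Laurent → Set
DegNeg x = ∃ λ n → HasDegree x n × (n ℤ.< + 0)

-- x has continued fraction expansion (1/β₀)(a₀ + β₁/(a₁ + β₂/(a₂ + ⋯))):
-- there are x₀ = x, x₁, … with βᵢxᵢ - aᵢ ≠ 0, deg(βᵢxᵢ - aᵢ) < 0 and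
-- x_{i+1} = 1/(βᵢxᵢ - aᵢ), i.e. x_{i+1}·(βᵢxᵢ - aᵢ) = 1.
HasCF : (ℕ → ℚ) → (ℕ → Laurent) → Laurent → Set
HasCF β a x = Σ (ℕ → Laurent) λ xs →
  (xs 0 ≈ x) ×
  (∀ i → DegNeg (β i • xs i -L a i) × (xs (suc i) *L (β i • xs i -L a i) ≈ 1L))

ℕtoℚ : ℕ → ℚ
ℕtoℚ n = (+ n) ℚ./ 1

βseq : ℕ → ℚ
βseq zero    = 1ℚ
βseq (suc k) = ℕtoℚ ((3 ℕ.* suc k ℕ.∸ 1) ℕ.* (3 ℕ.* suc k ℕ.+ 1))

aseq : ℕ → Laurent
aseq zero    = tL
aseq (suc k) = ℕtoℚ (2 ℕ.* suc k ℕ.+ 1) • tL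

P : Laurent → Laurent
P x = ℕtoℚ 3 • (x *L x *L x) -L ℕtoℚ 3 • (tL *L x *L x) -L ℕtoℚ 9 • x +L tL

-- Put s = t⁻¹ and x = t·f(s). Then P(x) = 0 becomes the cubic 3f³ − 3f² − 9s²f + s² = 0 in ℚ[[s]],
-- whose solutions with f(0) = 1 are f = 1 + s·w with w the fixed point of a contraction; so there is
-- exactly one, f₀. A root x of degree d ≥ 2 is impossible, since after scaling by t^(−3d) the
-- equation has constant term 3c³ for the leading coefficient c of x.
--
-- Differentiating the cubic shows that x₀ = t·f₀ satisfies the Riccati equation
-- (t² + 9)·x′ = b x² + (1 − C) t x + W with (b, C, W) = (1, 1, 1). Whenever x = t·f(s) satisfies such an
-- equation with f(0) ≠ 0, its first three coefficients give b x − C t = s·h(s) with h(0) ≠ 0, and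
-- 1/(b x − C t) satisfies the equation with (9C − W b, C + 2, −1). Starting from (1, 1, 1) this yields
-- the partial quotients (2i + 1)t and the numerators βᵢ = 9(2i − 1) − Wᵢ₋₁βᵢ₋₁ = (3i − 1)(3i + 1).

module Submission where

open import Data.Nat as ℕ using (ℕ; zero; suc; _<_; _⊔_; z<s; s<s; z≤n; s≤s)
import Data.Nat.Properties as ℕP
open import Data.Nat.Tactic.RingSolver using () renaming (solve-∀ to ℕ-solve-∀)
open import Data.Integer as ℤ using (-[1+_])
import Data.Integer.Properties as ℤP
open import Data.Integer.Tactic.RingSolver using () renaming (solve-∀ to ℤ-solve-∀)
open import Data.Rational as ℚ using (ℚ; 0ℚ; 1ℚ; _+_; _*_; -_; _-_; 1/_; mkℚ)
import Data.Rational.Properties as ℚP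
open import Data.Rational.Solver using (module +-*-Solver)
import Data.Nat.Coprimality as Coprime
open import Data.List using (applyUpTo)
open import Data.List.Properties using (map-upTo)
open import Data.Maybe using (Maybe; just; nothing)
open import Data.Product using (Σ; _×_; _,_; proj₁; proj₂)
open import Data.Sum using (_⊎_; inj₁; inj₂)
open import Data.Empty using (⊥-elim)
open import Function using (_∘_)
open import Relation.Nullary using (yes; no)
open import Relation.Binary.PropositionalEquality
import Relation.Binary.Reasoning.Setoid as SetoidReasoning
open import Algebra.Bundles using (CommutativeRing; CommutativeMonoid)
open import Algebra.Structures using (IsCommutativeRing)
import Algebra.Construct.Pointwise ℕ as Pointwise
import Algebra.Solver.Ring.AlmostCommutativeRing as ACR
import Algebra.Properties.CommutativeSemigroup as CommutativeSemigroupProperties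
open import Defs

open +-*-Solver using (solve; _:=_; _:+_; _:*_; :-_; _:-_; con)

module ℚ+ = CommutativeSemigroupProperties (CommutativeMonoid.commutativeSemigroup ℚP.+-0-commutativeMonoid)
module ℕ+ = CommutativeSemigroupProperties ℕP.+-commutativeSemigroup

ℕtoℚ≡mkℚ : ∀ n → ℕtoℚ n ≡ mkℚ (ℤ.+ n) 0 (Coprime.sym (Coprime.1-coprimeTo n))
ℕtoℚ≡mkℚ n = ℚP.normalize-coprime (Coprime.sym (Coprime.1-coprimeTo n))

ℕtoℚ-+ : ∀ m n → ℕtoℚ (m ℕ.+ n) ≡ ℕtoℚ m + ℕtoℚ n
ℕtoℚ-+ m n rewrite ℕtoℚ≡mkℚ m | ℕtoℚ≡mkℚ n =
  sym (ℚP./-cong {p₁ = ℤ.+ m ℤ.* ℤ.+ 1 ℤ.+ ℤ.+ n ℤ.* ℤ.+ 1} {q₁ = 1}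
        (cong₂ ℤ._+_ (ℤP.*-identityʳ (ℤ.+ m)) (ℤP.*-identityʳ (ℤ.+ n))) refl)

ℕtoℚ-* : ∀ m n → ℕtoℚ (m ℕ.* n) ≡ ℕtoℚ m * ℕtoℚ n
ℕtoℚ-* m n rewrite ℕtoℚ≡mkℚ m | ℕtoℚ≡mkℚ n =
  sym (ℚP./-cong {p₁ = ℤ.+ m ℤ.* ℤ.+ n} {q₁ = 1} (sym (ℤP.pos-* m n)) refl)

ℕtoℚ-injective : ∀ {m n} → ℕtoℚ m ≡ ℕtoℚ n → m ≡ n
ℕtoℚ-injective {m} {n} eq =
  ℤP.+-injective (cong ℚ.↥_ (trans (sym (ℕtoℚ≡mkℚ m)) (trans eq (ℕtoℚ≡mkℚ n))))

ℕtoℚ-suc : ∀ n → ℕtoℚ (suc n) ≡ ℕtoℚ n + 1ℚ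
ℕtoℚ-suc n = trans (ℕtoℚ-+ 1 n) (ℚP.+-comm 1ℚ (ℕtoℚ n))

p*q≡0⇒q≡0 : ∀ {p q} → p ≢ 0ℚ → p * q ≡ 0ℚ → q ≡ 0ℚ
p*q≡0⇒q≡0 {p} {q} p≢0 pq≡0 = begin
  q              ≡⟨ sym (ℚP.*-identityˡ q) ⟩
  1ℚ * q         ≡⟨ cong (_* q) (sym (ℚP.*-inverseˡ p)) ⟩
  (1/ p * p) * q ≡⟨ ℚP.*-assoc (1/ p) p q ⟩
  1/ p * (p * q) ≡⟨ cong (1/ p *_) pq≡0 ⟩
  1/ p * 0ℚ      ≡⟨ ℚP.*-zeroʳ (1/ p) ⟩
  0ℚ             ∎
  where open ≡-Reasoning
        instance _ = ℚ.≢-nonZero p≢0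

p*q≢0 : ∀ {p q} → p ≢ 0ℚ → q ≢ 0ℚ → p * q ≢ 0ℚ
p*q≢0 p≢0 q≢0 pq≡0 = q≢0 (p*q≡0⇒q≡0 p≢0 pq≡0)

3≢0 : ℕtoℚ 3 ≢ 0ℚ
3≢0 ()

p≡q⇒q-p≡0 : ∀ {p q} → p ≡ q → q - p ≡ 0ℚ
p≡q⇒q-p≡0 {p} refl = ℚP.+-inverseʳ p

p-q≡0⇒p≡q : ∀ {p q} → p - q ≡ 0ℚ → p ≡ q
p-q≡0⇒p≡q {p} {q} eq =
  trans (solve 2 (λ p q → p := (p :- q) :+ q) refl p q)
        (trans (cong (_+ q) eq) (ℚP.+-identityˡ q))

-- Formal power series over ℚ

Series : Set
Series = ℕ → ℚ

infixl 6 _⊕_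
infixl 7 _⊛_ _∙_

_⊕_ : Series → Series → Series
(f ⊕ g) n = f n + g n

⊖_ : Series → Series
(⊖ f) n = - f n

_∙_ : ℚ → Series → Series
(q ∙ f) n = q * f n

tail : Series → Series
tail f n = f (suc n)

_⊛_ : Series → Series → Series
(f ⊛ g) zero    = f 0 * g 0
(f ⊛ g) (suc n) = f 0 * g (suc n) + (tail f ⊛ g) n

cst : ℚ → Series
cst q zero    = q
cst q (suc _) = 0ℚ

𝟘 : Series
𝟘 _ = 0ℚ

⊛-cong : ∀ {f f′ g g′} → f ≗ f′ → g ≗ g′ → f ⊛ g ≗ f′ ⊛ g′
⊛-cong f≗f′ g≗g′ zero    = cong₂ _*_ (f≗f′ 0) (g≗g′ 0)
⊛-cong f≗f′ g≗g′ (suc n) =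
  cong₂ _+_ (cong₂ _*_ (f≗f′ 0) (g≗g′ (suc n))) (⊛-cong (f≗f′ ∘ suc) g≗g′ n)

⊛-zeroˡ : ∀ g → 𝟘 ⊛ g ≗ 𝟘
⊛-zeroˡ g zero    = ℚP.*-zeroˡ (g 0)
⊛-zeroˡ g (suc n) = trans (cong₂ _+_ (ℚP.*-zeroˡ (g (suc n))) (⊛-zeroˡ g n)) (ℚP.+-identityˡ 0ℚ)

cst⊛ : ∀ q g → cst q ⊛ g ≗ q ∙ g
cst⊛ q g zero    = refl
cst⊛ q g (suc n) = trans (cong (q * g (suc n) +_) (⊛-zeroˡ g n)) (ℚP.+-identityʳ _)

⊛-identityˡ : ∀ g → cst 1ℚ ⊛ g ≗ g
⊛-identityˡ g n = trans (cst⊛ 1ℚ g n) (ℚP.*-identityˡ (g n))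

⊛-distribʳ : ∀ h f g → (f ⊕ g) ⊛ h ≗ f ⊛ h ⊕ g ⊛ h
⊛-distribʳ h f g zero    = ℚP.*-distribʳ-+ (h 0) (f 0) (g 0)
⊛-distribʳ h f g (suc n) =
  trans (cong₂ _+_ (ℚP.*-distribʳ-+ (h (suc n)) (f 0) (g 0)) (⊛-distribʳ h (tail f) (tail g) n))
        (ℚ+.interchange (f 0 * h (suc n)) (g 0 * h (suc n)) ((tail f ⊛ h) n) ((tail g ⊛ h) n))

⊛-distribˡ : ∀ f g h → f ⊛ (g ⊕ h) ≗ f ⊛ g ⊕ f ⊛ h
⊛-distribˡ f g h zero    = ℚP.*-distribˡ-+ (f 0) (g 0) (h 0)
⊛-distribˡ f g h (suc n) =
  trans (cong₂ _+_ (ℚP.*-distribˡ-+ (f 0) (g (suc n)) (h (suc n))) (⊛-distribˡ (tail f) g h n))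
        (ℚ+.interchange (f 0 * g (suc n)) (f 0 * h (suc n)) ((tail f ⊛ g) n) ((tail f ⊛ h) n))

∙-⊛-assoc : ∀ q f g → (q ∙ f) ⊛ g ≗ q ∙ (f ⊛ g)
∙-⊛-assoc q f g zero    = ℚP.*-assoc q (f 0) (g 0)
∙-⊛-assoc q f g (suc n) =
  trans (cong₂ _+_ (ℚP.*-assoc q (f 0) (g (suc n))) (∙-⊛-assoc q (tail f) g n))
        (sym (ℚP.*-distribˡ-+ q _ _))

⊛-assoc : ∀ f g h → (f ⊛ g) ⊛ h ≗ f ⊛ (g ⊛ h)
⊛-assoc f g h zero    = ℚP.*-assoc (f 0) (g 0) (h 0)
⊛-assoc f g h (suc n) = begin
  (f 0 * g 0) * h (suc n) + ((f 0 ∙ tail g ⊕ tail f ⊛ g) ⊛ h) n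
    ≡⟨ cong ((f 0 * g 0) * h (suc n) +_) (⊛-distribʳ h (f 0 ∙ tail g) (tail f ⊛ g) n) ⟩
  (f 0 * g 0) * h (suc n) + (((f 0 ∙ tail g) ⊛ h) n + ((tail f ⊛ g) ⊛ h) n)
    ≡⟨ cong ((f 0 * g 0) * h (suc n) +_) (cong₂ _+_ (∙-⊛-assoc (f 0) (tail g) h n) (⊛-assoc (tail f) g h n)) ⟩
  (f 0 * g 0) * h (suc n) + (f 0 * (tail g ⊛ h) n + (tail f ⊛ (g ⊛ h)) n)
    ≡⟨ regroup (f 0) (g 0) (h (suc n)) ((tail g ⊛ h) n) ((tail f ⊛ (g ⊛ h)) n) ⟩
  f 0 * (g 0 * h (suc n) + (tail g ⊛ h) n) + (tail f ⊛ (g ⊛ h)) n ∎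
  where
  open ≡-Reasoning
  regroup : ∀ a b c d e → (a * b) * c + (a * d + e) ≡ a * (b * c + d) + e
  regroup = solve 5 (λ a b c d e → (a :* b) :* c :+ (a :* d :+ e) := a :* (b :* c :+ d) :+ e) refl

⊛-sucʳ : ∀ n f g → (f ⊛ g) (suc n) ≡ (f ⊛ tail g) n + f (suc n) * g 0
⊛-sucʳ zero    f g = refl
⊛-sucʳ (suc n) f g =
  trans (cong (f 0 * g (suc (suc n)) +_) (⊛-sucʳ n (tail f) g))
        (sym (ℚP.+-assoc (f 0 * g (suc (suc n))) ((tail f ⊛ tail g) n) (f (suc (suc n)) * g 0)))

⊛-comm : ∀ f g → f ⊛ g ≗ g ⊛ f
⊛-comm f g zero    = ℚP.*-comm (f 0) (g 0)
⊛-comm f g (suc n) = begin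
  f 0 * g (suc n) + (tail f ⊛ g) n ≡⟨ cong (f 0 * g (suc n) +_) (⊛-comm (tail f) g n) ⟩
  f 0 * g (suc n) + (g ⊛ tail f) n ≡⟨ ℚP.+-comm (f 0 * g (suc n)) _ ⟩
  (g ⊛ tail f) n + f 0 * g (suc n) ≡⟨ cong ((g ⊛ tail f) n +_) (ℚP.*-comm (f 0) (g (suc n))) ⟩
  (g ⊛ tail f) n + g (suc n) * f 0 ≡⟨ sym (⊛-sucʳ n g f) ⟩
  (g ⊛ f) (suc n)                  ∎
  where open ≡-Reasoning

⊛-isCommutativeRing : IsCommutativeRing _≗_ _⊕_ _⊛_ ⊖_ 𝟘 (cst 1ℚ)
⊛-isCommutativeRing = record
  { isRing = record
    { +-isAbelianGroup = Pointwise.isAbelianGroup ℚP.+-0-isAbelianGroup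
    ; *-cong           = ⊛-cong
    ; *-assoc          = ⊛-assoc
    ; *-identity       = ⊛-identityˡ , λ g n → trans (⊛-comm g (cst 1ℚ) n) (⊛-identityˡ g n)
    ; distrib          = ⊛-distribˡ , ⊛-distribʳ
    }
  ; *-comm = ⊛-comm
  }

seriesRing : CommutativeRing _ _
seriesRing = record { isCommutativeRing = ⊛-isCommutativeRing }

module R = CommutativeRing seriesRing
open import Algebra.Properties.Group R.+-group using (x∙y⁻¹≈ε⇒x≈y; x≈y⇒x∙y⁻¹≈ε)

module ≗-Reasoning = SetoidReasoning R.setoid

cst-homomorphism : ACR._-Raw-AlmostCommutative⟶_ ℚP.+-*-rawRing (ACR.fromCommutativeRing seriesRing)
cst-homomorphism = record
  { ⟦_⟧    = cst
  ; +-homo = λ { p q zero → refl ; p q (suc n) → sym (ℚP.+-identityˡ 0ℚ) }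
  ; *-homo = λ { p q zero → refl ; p q (suc n) → sym (trans (cst⊛ p (cst q) (suc n)) (ℚP.*-zeroʳ p)) }
  ; -‿homo = λ { p zero → refl ; p (suc n) → refl }
  ; 0-homo = λ { zero → refl ; (suc n) → refl }
  ; 1-homo = λ { zero → refl ; (suc n) → refl }
  }

cst-≟ : ∀ p q → Maybe (cst p ≗ cst q)
cst-≟ p q with p ℚ.≟ q
... | yes refl = just λ _ → refl
... | no _     = nothing

open import Algebra.Solver.Ring ℚP.+-*-rawRing (ACR.fromCommutativeRing seriesRing) cst-homomorphism cst-≟
  using ()
  renaming (solve to solve-series; _:=_ to _:≗_; _:+_ to _:⊕_; _:*_ to _:⊛_; :-_ to :⊖_; con to :cst)

open ACR._-Raw-AlmostCommutative⟶_ cst-homomorphism using (+-homo; *-homo; -‿homo)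

X : Series
X zero          = 0ℚ
X (suc zero)    = 1ℚ
X (suc (suc n)) = 0ℚ

tail-X : tail X ≗ cst 1ℚ
tail-X zero    = refl
tail-X (suc n) = refl

X⊛-zero : ∀ f → (X ⊛ f) 0 ≡ 0ℚ
X⊛-zero f = ℚP.*-zeroˡ (f 0)

X⊛-suc : ∀ f n → (X ⊛ f) (suc n) ≡ f n
X⊛-suc f n = begin
  0ℚ * f (suc n) + (tail X ⊛ f) n ≡⟨ cong₂ _+_ (ℚP.*-zeroˡ (f (suc n))) (⊛-cong tail-X (λ _ → refl) n) ⟩
  0ℚ + (cst 1ℚ ⊛ f) n             ≡⟨ ℚP.+-identityˡ _ ⟩
  (cst 1ℚ ⊛ f) n                  ≡⟨ ⊛-identityˡ f n ⟩
  f n                             ∎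
  where open ≡-Reasoning

series-expansion : ∀ f → f ≗ cst (f 0) ⊕ X ⊛ tail f
series-expansion f zero    = sym (trans (cong (f 0 +_) (X⊛-zero (tail f))) (ℚP.+-identityʳ (f 0)))
series-expansion f (suc n) = sym (trans (cong (0ℚ +_) (X⊛-suc (tail f) n)) (ℚP.+-identityˡ (f (suc n))))

X⊛-cancelˡ : ∀ {f g} → X ⊛ f ≗ X ⊛ g → f ≗ g
X⊛-cancelˡ {f} {g} eq n = trans (sym (X⊛-suc f n)) (trans (eq (suc n)) (X⊛-suc g n))

cst0≗𝟘 : cst 0ℚ ≗ 𝟘
cst0≗𝟘 zero    = refl
cst0≗𝟘 (suc n) = refl

X⊛f≗𝟘⇒f≗𝟘 : ∀ {f} → X ⊛ f ≗ 𝟘 → f ≗ 𝟘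
X⊛f≗𝟘⇒f≗𝟘 {f} Xf≗0 n = trans (sym (X⊛-suc f n)) (Xf≗0 (suc n))

⊛≗1⇒const≢0 : ∀ {f g} → f ⊛ g ≗ cst 1ℚ → g 0 ≢ 0ℚ
⊛≗1⇒const≢0 {f} fg≗1 g0≡0 =
  ℚP.1≢0 (trans (sym (fg≗1 0)) (trans (cong (f 0 *_) g0≡0) (ℚP.*-zeroʳ (f 0))))

-- Contractive maps

Agree : ℕ → Series → Series → Set
Agree n f g = ∀ j → j < n → f j ≡ g j

Agree-refl : ∀ {n} f → Agree n f f
Agree-refl f j _ = refl

Agree-⊕ : ∀ {n f f′ g g′} → Agree n f f′ → Agree n g g′ → Agree n (f ⊕ g) (f′ ⊕ g′)
Agree-⊕ f≈f′ g≈g′ j j<n = cong₂ _+_ (f≈f′ j j<n) (g≈g′ j j<n)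

Agree-⊖ : ∀ {n f f′} → Agree n f f′ → Agree n (⊖ f) (⊖ f′)
Agree-⊖ f≈f′ j j<n = cong -_ (f≈f′ j j<n)

Agree-∙ : ∀ {n f f′} q → Agree n f f′ → Agree n (q ∙ f) (q ∙ f′)
Agree-∙ q f≈f′ j j<n = cong (q *_) (f≈f′ j j<n)

⊛-causal : ∀ n f f′ g g′ → Agree (suc n) f f′ → Agree (suc n) g g′ → (f ⊛ g) n ≡ (f′ ⊛ g′) n
⊛-causal zero    f f′ g g′ f≈f′ g≈g′ = cong₂ _*_ (f≈f′ 0 z<s) (g≈g′ 0 z<s)
⊛-causal (suc n) f f′ g g′ f≈f′ g≈g′ =
  cong₂ _+_ (cong₂ _*_ (f≈f′ 0 z<s) (g≈g′ (suc n) ℕP.≤-refl))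
            (⊛-causal n (tail f) (tail f′) g g′ (λ j j<n → f≈f′ (suc j) (s<s j<n))
                                                (λ j j<n → g≈g′ j (ℕP.m<n⇒m<1+n j<n)))

Agree-⊛ : ∀ {n f f′ g g′} → Agree n f f′ → Agree n g g′ → Agree n (f ⊛ g) (f′ ⊛ g′)
Agree-⊛ {f = f} {f′} {g} {g′} f≈f′ g≈g′ j j<n =
  ⊛-causal j f f′ g g′ (λ i i≤j → f≈f′ i (ℕP.<-≤-trans i≤j j<n)) (λ i i≤j → g≈g′ i (ℕP.<-≤-trans i≤j j<n))

Agree-X⊛ : ∀ {n f f′} → Agree n f f′ → Agree (suc n) (X ⊛ f) (X ⊛ f′)
Agree-X⊛ {f = f} {f′} f≈f′ zero    _         = trans (X⊛-zero f) (sym (X⊛-zero f′))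
Agree-X⊛ {f = f} {f′} f≈f′ (suc j) (s<s j<n) = trans (X⊛-suc f j) (trans (f≈f′ j j<n) (sym (X⊛-suc f′ j)))

Contractive : (Series → Series) → Set
Contractive Φ = ∀ n f g → Agree n f g → Φ f n ≡ Φ g n

module Fixpoint (Φ : Series → Series) (contractive : Contractive Φ) where

  iterate : ℕ → Series
  iterate zero    = 𝟘
  iterate (suc k) = Φ (iterate k)

  iterate-stable : ∀ k m → Agree k (iterate k) (iterate (k ℕ.+ m))
  iterate-stable (suc k) m j j<1+k =
    contractive j (iterate k) (iterate (k ℕ.+ m))
      (λ i i<j → iterate-stable k m i (ℕP.<-≤-trans i<j (ℕP.≤-pred j<1+k)))

  -- The j-th coefficient has stabilised after j + 1 iterations.
  fix : Series
  fix j = iterate (suc j) j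

  fix-agree : ∀ n → Agree n fix (iterate n)
  fix-agree n j j<n = trans (iterate-stable (suc j) (n ℕ.∸ suc j) j ℕP.≤-refl)
                            (cong (λ k → iterate k j) (ℕP.m+[n∸m]≡n j<n))

  fix-equation : fix ≗ Φ fix
  fix-equation n = sym (contractive n fix (iterate n) (fix-agree n))

  fixedPoint-agree : ∀ g → g ≗ Φ g → ∀ k → Agree k g (iterate k)
  fixedPoint-agree g g≗Φg (suc k) j j<1+k =
    trans (g≗Φg j) (contractive j g (iterate k)
      (λ i i<j → fixedPoint-agree g g≗Φg k i (ℕP.<-≤-trans i<j (ℕP.≤-pred j<1+k))))

  fix-unique : ∀ g → g ≗ Φ g → g ≗ fix
  fix-unique g g≗Φg n = fixedPoint-agree g g≗Φg (suc n) n ℕP.≤-refl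

-- Writing h = h₀ + X·tail h, the equation h ⊛ g = 1 becomes the fixed-point
-- equation g = h₀⁻¹ (1 − X·(tail h ⊛ g)), whose right-hand side is contractive.
⊛-inverse : ∀ h → h 0 ≢ 0ℚ → Σ Series λ g → h ⊛ g ≗ cst 1ℚ
⊛-inverse h h0≢0 = inv , ⊛-inverseʳ
  where
  instance _ = ℚ.≢-nonZero h0≢0

  Φ : Series → Series
  Φ g = 1/ (h 0) ∙ (cst 1ℚ ⊕ ⊖ (X ⊛ (tail h ⊛ g)))

  Φ-contractive : Contractive Φ
  Φ-contractive n f g f≈g =
    Agree-∙ (1/ (h 0)) (Agree-⊕ (Agree-refl (cst 1ℚ)) (Agree-⊖ (Agree-X⊛ (Agree-⊛ (Agree-refl (tail h)) f≈g))))
      n ℕP.≤-refl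

  open Fixpoint Φ Φ-contractive renaming (fix to inv; fix-equation to inv-equation)

  h0-cancel : ∀ f → cst (h 0) ⊛ (1/ (h 0) ∙ f) ≗ f
  h0-cancel f n = begin
    (cst (h 0) ⊛ (1/ (h 0) ∙ f)) n ≡⟨ cst⊛ (h 0) _ n ⟩
    h 0 * (1/ (h 0) * f n)         ≡⟨ sym (ℚP.*-assoc (h 0) (1/ (h 0)) (f n)) ⟩
    (h 0 * 1/ (h 0)) * f n         ≡⟨ cong (_* f n) (ℚP.*-inverseʳ (h 0)) ⟩
    1ℚ * f n                       ≡⟨ ℚP.*-identityˡ (f n) ⟩
    f n                            ∎
    where open ≡-Reasoning

  ⊛-inverseʳ : h ⊛ inv ≗ cst 1ℚ
  ⊛-inverseʳ = begin
    h ⊛ inv                                      ≈⟨ ⊛-cong (series-expansion h) inv-equation ⟩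
    (cst (h 0) ⊕ X ⊛ tail h) ⊛ Φ inv             ≈⟨ ⊛-distribʳ (Φ inv) (cst (h 0)) (X ⊛ tail h) ⟩
    cst (h 0) ⊛ Φ inv ⊕ X ⊛ tail h ⊛ Φ inv       ≈⟨ R.+-cong (h0-cancel (cst 1ℚ ⊕ ⊖ Y)) (⊛-cong (λ _ → refl) (R.sym inv-equation)) ⟩
    (cst 1ℚ ⊕ ⊖ Y) ⊕ X ⊛ tail h ⊛ inv            ≈⟨ R.+-cong (R.refl {cst 1ℚ ⊕ ⊖ Y}) (⊛-assoc X (tail h) inv) ⟩
    (cst 1ℚ ⊕ ⊖ Y) ⊕ Y                           ≈⟨ solve-series 2 (λ a y → (a :⊕ :⊖ y) :⊕ y :≗ a) R.refl (cst 1ℚ) Y ⟩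
    cst 1ℚ                                       ∎
    where
    open ≗-Reasoning
    Y = X ⊛ (tail h ⊛ inv)

⊛-cancelʳ-unit : ∀ {f u} → u 0 ≢ 0ℚ → f ⊛ u ≗ 𝟘 → f ≗ 𝟘
⊛-cancelʳ-unit {f} {u} u0≢0 fu≗0 = begin
  f                 ≈⟨ R.sym (R.*-identityʳ f) ⟩
  f ⊛ cst 1ℚ        ≈⟨ R.*-cong (R.refl {f}) (R.sym uv≗1) ⟩
  f ⊛ (u ⊛ v)       ≈⟨ R.sym (⊛-assoc f u v) ⟩
  (f ⊛ u) ⊛ v       ≈⟨ R.*-cong fu≗0 (R.refl {v}) ⟩
  𝟘 ⊛ v             ≈⟨ ⊛-zeroˡ v ⟩
  𝟘                 ∎
  where
  open ≗-Reasoning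
  v = proj₁ (⊛-inverse u u0≢0)
  uv≗1 = proj₂ (⊛-inverse u u0≢0)

δ : Series → Series
δ f n = ℕtoℚ n * f n

δ-cong : ∀ {f g} → f ≗ g → δ f ≗ δ g
δ-cong f≗g n = cong (ℕtoℚ n *_) (f≗g n)

δ-⊕ : ∀ f g → δ (f ⊕ g) ≗ δ f ⊕ δ g
δ-⊕ f g n = ℚP.*-distribˡ-+ (ℕtoℚ n) (f n) (g n)

δ-⊖ : ∀ f → δ (⊖ f) ≗ ⊖ δ f
δ-⊖ f n = sym (ℚP.neg-distribʳ-* (ℕtoℚ n) (f n))

δ-cst : ∀ q → δ (cst q) ≗ 𝟘
δ-cst q zero    = ℚP.*-zeroˡ q
δ-cst q (suc n) = ℚP.*-zeroʳ (ℕtoℚ (suc n))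

δ-X : δ X ≗ X
δ-X zero          = refl
δ-X (suc zero)    = refl
δ-X (suc (suc n)) = ℚP.*-zeroʳ (ℕtoℚ (suc (suc n)))

tail-δ : ∀ f → tail (δ f) ≗ δ (tail f) ⊕ tail f
tail-δ f n = begin
  ℕtoℚ (suc n) * f (suc n)             ≡⟨ cong (_* f (suc n)) (ℕtoℚ-suc n) ⟩
  (ℕtoℚ n + 1ℚ) * f (suc n)            ≡⟨ ℚP.*-distribʳ-+ (f (suc n)) (ℕtoℚ n) 1ℚ ⟩
  ℕtoℚ n * f (suc n) + 1ℚ * f (suc n)  ≡⟨ cong (ℕtoℚ n * f (suc n) +_) (ℚP.*-identityˡ (f (suc n))) ⟩
  ℕtoℚ n * f (suc n) + f (suc n)       ∎
  where open ≡-Reasoning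

δ-⊛ : ∀ f g → δ (f ⊛ g) ≗ δ f ⊛ g ⊕ f ⊛ δ g
δ-⊛ f g zero =
  solve 2 (λ a b → con 0ℚ :* (a :* b) := (con 0ℚ :* a) :* b :+ a :* (con 0ℚ :* b)) refl (f 0) (g 0)
δ-⊛ f g (suc n) = begin
  ℕtoℚ (suc n) * (a * b + M)                        ≡⟨ cong (_* (a * b + M)) (ℕtoℚ-suc n) ⟩
  (N + 1ℚ) * (a * b + M)                            ≡⟨ expand a b N M ⟩
  N * M + (M + a * ((N + 1ℚ) * b))                  ≡⟨ cong (_+ (M + a * ((N + 1ℚ) * b))) (δ-⊛ (tail f) g n) ⟩
  (A + B) + (M + a * ((N + 1ℚ) * b))                ≡⟨ regroup a b N M A B ⟩
  (0ℚ * a * b + (A + M)) + (a * ((N + 1ℚ) * b) + B) ≡⟨ cong₂ (λ u v → (0ℚ * a * b + u) + (a * v + B)) tail-δf⊛g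
                                                              (cong (_* b) (sym (ℕtoℚ-suc n))) ⟩
  (δ f ⊛ g ⊕ f ⊛ δ g) (suc n)                       ∎
  where
  open ≡-Reasoning
  a = f 0
  b = g (suc n)
  N = ℕtoℚ n
  M = (tail f ⊛ g) n
  A = (δ (tail f) ⊛ g) n
  B = (tail f ⊛ δ g) n
  tail-δf⊛g : A + M ≡ (tail (δ f) ⊛ g) n
  tail-δf⊛g = sym (trans (⊛-cong (tail-δ f) (λ _ → refl) n) (⊛-distribʳ g (δ (tail f)) (tail f) n))
  expand : ∀ a b N M → (N + 1ℚ) * (a * b + M) ≡ N * M + (M + a * ((N + 1ℚ) * b))
  expand = solve 4 (λ a b N M → (N :+ con 1ℚ) :* (a :* b :+ M) := N :* M :+ (M :+ a :* ((N :+ con 1ℚ) :* b))) refl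
  regroup : ∀ a b N M A B → (A + B) + (M + a * ((N + 1ℚ) * b)) ≡ (0ℚ * a * b + (A + M)) + (a * ((N + 1ℚ) * b) + B)
  regroup = solve 6 (λ a b N M A B → (A :+ B) :+ (M :+ a :* ((N :+ con 1ℚ) :* b))
                                  := (con 0ℚ :* a :* b :+ (A :+ M)) :+ (a :* ((N :+ con 1ℚ) :* b) :+ B)) refl

⊕-derivative : ∀ {f g f′ g′} → δ f ≗ f′ → δ g ≗ g′ → δ (f ⊕ g) ≗ f′ ⊕ g′
⊕-derivative {f} {g} δf≗f′ δg≗g′ = R.trans (δ-⊕ f g) (R.+-cong δf≗f′ δg≗g′)

⊖-derivative : ∀ {f f′} → δ f ≗ f′ → δ (⊖ f) ≗ ⊖ f′
⊖-derivative {f} δf≗f′ = R.trans (δ-⊖ f) (R.-‿cong δf≗f′)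

⊛-derivative : ∀ {f g f′ g′} → δ f ≗ f′ → δ g ≗ g′ → δ (f ⊛ g) ≗ f′ ⊛ g ⊕ f ⊛ g′
⊛-derivative {f} {g} δf≗f′ δg≗g′ = R.trans (δ-⊛ f g) (R.+-cong (⊛-cong δf≗f′ (R.refl {g})) (⊛-cong (R.refl {f}) δg≗g′))

cst⊛-derivative : ∀ q {g g′} → δ g ≗ g′ → δ (cst q ⊛ g) ≗ cst q ⊛ g′
cst⊛-derivative q {g} {g′} δg≗g′ =
  R.trans (⊛-derivative (δ-cst q) δg≗g′) (R.trans (R.+-cong (⊛-zeroˡ g) (R.refl {cst q ⊛ g′})) (R.+-identityˡ _))

X²-derivative : δ (X ⊛ X) ≗ X ⊛ X ⊕ X ⊛ X
X²-derivative = ⊛-derivative δ-X δ-X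

-- The cubic

-- The equation P(x) = 0 for x = t·f(1/t), divided by t³.
Cubic : Series → Series
Cubic f = cst (ℕtoℚ 3) ⊛ (f ⊛ f ⊛ f) ⊕ ⊖ (cst (ℕtoℚ 3) ⊛ (f ⊛ f)) ⊕ ⊖ (cst (ℕtoℚ 9) ⊛ (X ⊛ X ⊛ f)) ⊕ X ⊛ X

Cubic-cong : ∀ {f g} → f ≗ g → Cubic f ≗ Cubic g
Cubic-cong {f} {g} f≗g =
  R.+-cong (R.+-cong (R.+-cong (R.*-cong (R.refl {cst (ℕtoℚ 3)}) (⊛-cong (⊛-cong f≗g f≗g) f≗g))
                               (R.-‿cong (R.*-cong (R.refl {cst (ℕtoℚ 3)}) (⊛-cong f≗g f≗g))))
                     (R.-‿cong (R.*-cong (R.refl {cst (ℕtoℚ 9)}) (⊛-cong (R.refl {X ⊛ X}) f≗g))))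
           (R.refl {X ⊛ X})

-- Roots with constant term 1 are the series 1 + X·w with w = cubicStep w.
cubicStep : Series → Series
cubicStep w = X ⊛ (cst (1/ ℕtoℚ 3) ⊛ (cst (ℕtoℚ 8) ⊕ cst (ℕtoℚ 9) ⊛ X ⊛ w ⊕ ⊖ (cst (ℕtoℚ 6) ⊛ w ⊛ w)
                                        ⊕ ⊖ (cst (ℕtoℚ 3) ⊛ X ⊛ w ⊛ w ⊛ w)))

Cubic-1+X⊛ : ∀ w → Cubic (cst 1ℚ ⊕ X ⊛ w) ≗ cst (ℕtoℚ 3) ⊛ X ⊛ (w ⊕ ⊖ cubicStep w)
Cubic-1+X⊛ w = solve-series 2 (λ x w →
     :cst (ℕtoℚ 3) :⊛ ((:cst 1ℚ :⊕ x :⊛ w) :⊛ (:cst 1ℚ :⊕ x :⊛ w) :⊛ (:cst 1ℚ :⊕ x :⊛ w))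
     :⊕ :⊖ (:cst (ℕtoℚ 3) :⊛ ((:cst 1ℚ :⊕ x :⊛ w) :⊛ (:cst 1ℚ :⊕ x :⊛ w)))
     :⊕ :⊖ (:cst (ℕtoℚ 9) :⊛ (x :⊛ x :⊛ (:cst 1ℚ :⊕ x :⊛ w))) :⊕ x :⊛ x
     :≗ :cst (ℕtoℚ 3) :⊛ x :⊛ (w :⊕ :⊖ (x :⊛ (:cst (1/ ℕtoℚ 3) :⊛ (:cst (ℕtoℚ 8) :⊕ :cst (ℕtoℚ 9) :⊛ x :⊛ w
         :⊕ :⊖ (:cst (ℕtoℚ 6) :⊛ w :⊛ w) :⊕ :⊖ (:cst (ℕtoℚ 3) :⊛ x :⊛ w :⊛ w :⊛ w)))))) R.refl X w

cubicStep-contractive : Contractive cubicStep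
cubicStep-contractive n f g f≈g = Agree-X⊛ (Agree-⊛ (Agree-refl (cst (1/ ℕtoℚ 3)))
  (Agree-⊕ (Agree-⊕ (Agree-⊕ (Agree-refl (cst (ℕtoℚ 8))) (Agree-⊛ (Agree-refl (cst (ℕtoℚ 9) ⊛ X)) f≈g))
                    (Agree-⊖ (Agree-⊛ (Agree-⊛ (Agree-refl (cst (ℕtoℚ 6))) f≈g) f≈g)))
           (Agree-⊖ (Agree-⊛ (Agree-⊛ (Agree-⊛ (Agree-refl (cst (ℕtoℚ 3) ⊛ X)) f≈g) f≈g) f≈g))))
  n ℕP.≤-refl

open Fixpoint cubicStep cubicStep-contractive
  using () renaming (fix to w₀; fix-equation to w₀-equation; fix-unique to w₀-unique)

f₀ : Series
f₀ = cst 1ℚ ⊕ X ⊛ w₀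

f₀-const : f₀ 0 ≡ 1ℚ
f₀-const = trans (cong (1ℚ +_) (X⊛-zero w₀)) (ℚP.+-identityʳ 1ℚ)

Cubic-f₀ : Cubic f₀ ≗ 𝟘
Cubic-f₀ = begin
  Cubic f₀                                    ≈⟨ Cubic-1+X⊛ w₀ ⟩
  cst (ℕtoℚ 3) ⊛ X ⊛ (w₀ ⊕ ⊖ cubicStep w₀)    ≈⟨ R.*-cong (R.refl {cst (ℕtoℚ 3) ⊛ X}) (x≈y⇒x∙y⁻¹≈ε w₀-equation) ⟩
  cst (ℕtoℚ 3) ⊛ X ⊛ 𝟘                        ≈⟨ R.zeroʳ _ ⟩
  𝟘                                           ∎
  where open ≗-Reasoning

f₀-unique : ∀ ψ → Cubic ψ ≗ 𝟘 → ψ 0 ≡ 1ℚ → ψ ≗ f₀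
f₀-unique ψ Cubicψ≗0 ψ0≡1 = begin
  ψ                      ≈⟨ ψ-expansion ⟩
  cst 1ℚ ⊕ X ⊛ tail ψ    ≈⟨ R.+-cong (R.refl {cst 1ℚ}) (R.*-cong (R.refl {X}) (w₀-unique (tail ψ) tailψ-fixed)) ⟩
  f₀                     ∎
  where
  open ≗-Reasoning
  ψ-expansion : ψ ≗ cst 1ℚ ⊕ X ⊛ tail ψ
  ψ-expansion = R.trans (series-expansion ψ)
    (R.+-cong {cst (ψ 0)} {cst 1ℚ} (λ { zero → ψ0≡1 ; (suc n) → refl }) (R.refl {X ⊛ tail ψ}))
  3X⊛defect≗0 : cst (ℕtoℚ 3) ⊛ X ⊛ (tail ψ ⊕ ⊖ cubicStep (tail ψ)) ≗ 𝟘
  3X⊛defect≗0 = R.trans (R.sym (Cubic-1+X⊛ (tail ψ))) (R.trans (R.sym (Cubic-cong ψ-expansion)) Cubicψ≗0)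
  tailψ-fixed : tail ψ ≗ cubicStep (tail ψ)
  tailψ-fixed = x∙y⁻¹≈ε⇒x≈y _ _ (X⊛f≗𝟘⇒f≗𝟘 (⊛-cancelʳ-unit {u = cst (ℕtoℚ 3)} 3≢0
    (R.trans (R.trans (⊛-comm _ _) (R.sym (⊛-assoc (cst (ℕtoℚ 3)) X _))) 3X⊛defect≗0)))

∂Cubic : Series → Series
∂Cubic f = cst (ℕtoℚ 9) ⊛ (f ⊛ f) ⊕ ⊖ (cst (ℕtoℚ 6) ⊛ f) ⊕ ⊖ (cst (ℕtoℚ 9) ⊛ (X ⊛ X))

δ-Cubic : ∀ f → δ (Cubic f) ≗ ∂Cubic f ⊛ δ f ⊕ cst (ℕtoℚ 2) ⊛ (X ⊛ X) ⊛ (cst 1ℚ ⊕ ⊖ (cst (ℕtoℚ 9) ⊛ f))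
δ-Cubic f = R.trans
  (⊕-derivative (⊕-derivative (⊕-derivative (cst⊛-derivative _ (⊛-derivative (⊛-derivative R.refl R.refl) R.refl))
                                           (⊖-derivative (cst⊛-derivative _ (⊛-derivative R.refl R.refl))))
                             (⊖-derivative (cst⊛-derivative _ (⊛-derivative X²-derivative R.refl))))
                X²-derivative)
  (solve-series 3 (λ f D x →
      :cst (ℕtoℚ 3) :⊛ ((D :⊛ f :⊕ f :⊛ D) :⊛ f :⊕ f :⊛ f :⊛ D) :⊕ :⊖ (:cst (ℕtoℚ 3) :⊛ (D :⊛ f :⊕ f :⊛ D))
        :⊕ :⊖ (:cst (ℕtoℚ 9) :⊛ ((x :⊛ x :⊕ x :⊛ x) :⊛ f :⊕ x :⊛ x :⊛ D)) :⊕ (x :⊛ x :⊕ x :⊛ x)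
      :≗ (:cst (ℕtoℚ 9) :⊛ (f :⊛ f) :⊕ :⊖ (:cst (ℕtoℚ 6) :⊛ f) :⊕ :⊖ (:cst (ℕtoℚ 9) :⊛ (x :⊛ x))) :⊛ D
        :⊕ :cst (ℕtoℚ 2) :⊛ (x :⊛ x) :⊛ (:cst 1ℚ :⊕ :⊖ (:cst (ℕtoℚ 9) :⊛ f))) R.refl f (δ f) X)

-- Riccati equations

1+9X² : Series
1+9X² = cst 1ℚ ⊕ cst (ℕtoℚ 9) ⊛ (X ⊛ X)

-- For x = t·f(1/t) this is the Riccati equation (t² + 9)·dx/dt = b x² + (1 − C) t x + W.
Riccati : ℚ → ℚ → ℚ → Series → Set
Riccati b C W f = 1+9X² ⊛ (f ⊕ ⊖ δ f) ≗ cst b ⊛ (f ⊛ f) ⊕ cst (1ℚ - C) ⊛ f ⊕ cst W ⊛ (X ⊛ X)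

-- The constant term is 9 − 6 = 3.
∂Cubic-f₀-const≢0 : ∂Cubic f₀ 0 ≢ 0ℚ
∂Cubic-f₀-const≢0 eq = 3≢0 (trans (cong (λ a → ℕtoℚ 9 * (a * a) + - (ℕtoℚ 6 * a) + - (ℕtoℚ 9 * (0ℚ * 0ℚ))) (sym f₀-const)) eq)

-- Differentiating Cubic f₀ ≗ 𝟘 gives ∂Cubic f₀ ⊛ δ f₀ in terms of f₀; the Riccati
-- defect times ∂Cubic f₀ is a combination of Cubic f₀ and δ (Cubic f₀).
Riccati-f₀ : Riccati 1ℚ 1ℚ 1ℚ f₀
Riccati-f₀ = x∙y⁻¹≈ε⇒x≈y _ _ (⊛-cancelʳ-unit ∂Cubic-f₀-const≢0 (begin
  (1+9X² ⊛ (f₀ ⊕ ⊖ δ f₀) ⊕ ⊖ (cst 1ℚ ⊛ (f₀ ⊛ f₀) ⊕ cst (1ℚ - 1ℚ) ⊛ f₀ ⊕ cst 1ℚ ⊛ (X ⊛ X))) ⊛ ∂Cubic f₀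
     ≈⟨ identity f₀ (δ f₀) X ⟩
  α ⊛ Cubic f₀ ⊕ ⊖ (1+9X² ⊛ δCubic)  ≈⟨ R.+-cong (R.*-cong (R.refl {α}) Cubic-f₀) (R.-‿cong (R.*-cong (R.refl {1+9X²}) δCubic≗𝟘)) ⟩
  α ⊛ 𝟘 ⊕ ⊖ (1+9X² ⊛ 𝟘)              ≈⟨ R.+-cong (R.zeroʳ α) (R.-‿cong (R.zeroʳ 1+9X²)) ⟩
  𝟘 ⊕ ⊖ 𝟘                        ≈⟨ R.-‿inverseʳ 𝟘 ⟩
  𝟘                              ∎))
  where
  open ≗-Reasoning
  α = cst (ℕtoℚ 2) ⊕ ⊖ (cst (ℕtoℚ 3) ⊛ f₀) ⊕ cst (ℕtoℚ 27) ⊛ (X ⊛ X)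
  δCubic = ∂Cubic f₀ ⊛ δ f₀ ⊕ cst (ℕtoℚ 2) ⊛ (X ⊛ X) ⊛ (cst 1ℚ ⊕ ⊖ (cst (ℕtoℚ 9) ⊛ f₀))
  δCubic≗𝟘 : δCubic ≗ 𝟘
  δCubic≗𝟘 = R.trans (R.sym (δ-Cubic f₀)) (R.trans (δ-cong Cubic-f₀) (λ n → ℚP.*-zeroʳ (ℕtoℚ n)))
  identity = solve-series 3 (λ f D x →
    ((:cst 1ℚ :⊕ :cst (ℕtoℚ 9) :⊛ (x :⊛ x)) :⊛ (f :⊕ :⊖ D)
       :⊕ :⊖ (:cst 1ℚ :⊛ (f :⊛ f) :⊕ :cst (1ℚ - 1ℚ) :⊛ f :⊕ :cst 1ℚ :⊛ (x :⊛ x)))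
       :⊛ (:cst (ℕtoℚ 9) :⊛ (f :⊛ f) :⊕ :⊖ (:cst (ℕtoℚ 6) :⊛ f) :⊕ :⊖ (:cst (ℕtoℚ 9) :⊛ (x :⊛ x)))
    :≗ (:cst (ℕtoℚ 2) :⊕ :⊖ (:cst (ℕtoℚ 3) :⊛ f) :⊕ :cst (ℕtoℚ 27) :⊛ (x :⊛ x))
         :⊛ (:cst (ℕtoℚ 3) :⊛ (f :⊛ f :⊛ f) :⊕ :⊖ (:cst (ℕtoℚ 3) :⊛ (f :⊛ f)) :⊕ :⊖ (:cst (ℕtoℚ 9) :⊛ (x :⊛ x :⊛ f)) :⊕ x :⊛ x)
       :⊕ :⊖ ((:cst 1ℚ :⊕ :cst (ℕtoℚ 9) :⊛ (x :⊛ x))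
         :⊛ ((:cst (ℕtoℚ 9) :⊛ (f :⊛ f) :⊕ :⊖ (:cst (ℕtoℚ 6) :⊛ f) :⊕ :⊖ (:cst (ℕtoℚ 9) :⊛ (x :⊛ x))) :⊛ D
           :⊕ :cst (ℕtoℚ 2) :⊛ (x :⊛ x) :⊛ (:cst 1ℚ :⊕ :⊖ (:cst (ℕtoℚ 9) :⊛ f))))) R.refl

Riccati-coefficient : ∀ {b C W f} → Riccati b C W f → ∀ n →
                      (1+9X² ⊛ (f ⊕ ⊖ δ f)) n ≡ b * (f ⊛ f) n + (1ℚ - C) * f n + W * (X ⊛ X) n
Riccati-coefficient {b} {C} {W} {f} ric n =
  trans (ric n) (cong₂ _+_ (cong₂ _+_ (cst⊛ b (f ⊛ f) n) (cst⊛ (1ℚ - C) f n)) (cst⊛ W (X ⊛ X) n))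

-- The identities below match the unfolded coefficients of Riccati-coefficient literally,
-- including the factors 1ℚ and 0ℚ that come from the coefficients of 1+9X².
Riccati-const : ∀ {b C W f} → Riccati b C W f → f 0 ≢ 0ℚ → b * f 0 ≡ C
Riccati-const {b} {C} {W} {f} ric f0≢0 =
  p-q≡0⇒p≡q (p*q≡0⇒q≡0 f0≢0 (trans (identity (f 0) b C W) (p≡q⇒q-p≡0 (Riccati-coefficient {b} {C} {W} {f} ric 0))))
  where
  identity : ∀ a b C W → a * (b * a - C) ≡ (b * (a * a) + (1ℚ - C) * a + W * 0ℚ) - 1ℚ * (a + - (0ℚ * a))
  identity = solve 4 (λ a b C W → a :* (b :* a :- C)
    := (b :* (a :* a) :+ (con 1ℚ :- C) :* a :+ W :* con 0ℚ) :- con 1ℚ :* (a :+ :- (con 0ℚ :* a))) refl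

Riccati-linear : ∀ {b C W f} → Riccati b C W f → b * f 0 ≡ C → C + 1ℚ ≢ 0ℚ → f 1 ≡ 0ℚ
Riccati-linear {b} {C} {W} {f} ric bf0≡C C+1≢0 = p*q≡0⇒q≡0 C+1≢0
  (trans (identity (f 0) (f 1) b C W)
  (trans (cong₂ (λ u v → u - ℕtoℚ 2 * f 1 * v) (p≡q⇒q-p≡0 (Riccati-coefficient {b} {C} {W} {f} ric 1)) (p≡q⇒q-p≡0 (sym bf0≡C)))
         (solve 1 (λ f₁ → con 0ℚ :- con (ℕtoℚ 2) :* f₁ :* con 0ℚ := con 0ℚ) refl (f 1))))
  where
  identity : ∀ a f₁ b C W → (C + 1ℚ) * f₁ ≡
    ((b * (a * f₁ + f₁ * a) + (1ℚ - C) * f₁ + W * 0ℚ) - (1ℚ * (f₁ + - (1ℚ * f₁)) + 0ℚ * (a + - (0ℚ * a))))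
      - ℕtoℚ 2 * f₁ * (b * a - C)
  identity = solve 5 (λ a f₁ b C W → (C :+ con 1ℚ) :* f₁
    := ((b :* (a :* f₁ :+ f₁ :* a) :+ (con 1ℚ :- C) :* f₁ :+ W :* con 0ℚ)
         :- (con 1ℚ :* (f₁ :+ :- (con 1ℚ :* f₁)) :+ con 0ℚ :* (a :+ :- (con 0ℚ :* a))))
       :- con (ℕtoℚ 2) :* f₁ :* (b :* a :- C)) refl

Riccati-quadratic : ∀ {b C W f} → Riccati b C W f → b * f 0 ≡ C → f 1 ≡ 0ℚ →
                    (C + ℕtoℚ 2) * (b * f 2) ≡ ℕtoℚ 9 * C - W * b
Riccati-quadratic {b} {C} {W} {f} ric bf0≡C f1≡0 = p-q≡0⇒p≡q
  (trans (identity (f 0) (f 1) (f 2) b C W)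
  (trans (cong₂ (λ u v → b * u - b * b * f 1 * f 1 - ℕtoℚ 2 * b * f 2 * v + ℕtoℚ 9 * v)
                (p≡q⇒q-p≡0 (Riccati-coefficient {b} {C} {W} {f} ric 2)) (p≡q⇒q-p≡0 (sym bf0≡C)))
  (trans (cong (λ f₁ → b * 0ℚ - b * b * f₁ * f₁ - ℕtoℚ 2 * b * f 2 * 0ℚ + ℕtoℚ 9 * 0ℚ) f1≡0)
         (solve 2 (λ b f₂ → b :* con 0ℚ :- b :* b :* con 0ℚ :* con 0ℚ :- con (ℕtoℚ 2) :* b :* f₂ :* con 0ℚ
                            :+ con (ℕtoℚ 9) :* con 0ℚ := con 0ℚ) refl b (f 2)))))
  where
  identity : ∀ a f₁ f₂ b C W → (C + ℕtoℚ 2) * (b * f₂) - (ℕtoℚ 9 * C - W * b) ≡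
    b * ((b * (a * f₂ + (f₁ * f₁ + f₂ * a)) + (1ℚ - C) * f₂ + W * 1ℚ)
          - (1ℚ * (f₂ + - (ℕtoℚ 2 * f₂)) + (0ℚ * (f₁ + - (1ℚ * f₁)) + ℕtoℚ 9 * (a + - (0ℚ * a)))))
      - b * b * f₁ * f₁ - ℕtoℚ 2 * b * f₂ * (b * a - C) + ℕtoℚ 9 * (b * a - C)
  identity = solve 6 (λ a f₁ f₂ b C W → (C :+ con (ℕtoℚ 2)) :* (b :* f₂) :- (con (ℕtoℚ 9) :* C :- W :* b)
    := b :* ((b :* (a :* f₂ :+ (f₁ :* f₁ :+ f₂ :* a)) :+ (con 1ℚ :- C) :* f₂ :+ W :* con 1ℚ)
             :- (con 1ℚ :* (f₂ :+ :- (con (ℕtoℚ 2) :* f₂)) :+ (con 0ℚ :* (f₁ :+ :- (con 1ℚ :* f₁)) :+ con (ℕtoℚ 9) :* (a :+ :- (con 0ℚ :* a)))))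
       :- b :* b :* f₁ :* f₁ :- con (ℕtoℚ 2) :* b :* f₂ :* (b :* a :- C) :+ con (ℕtoℚ 9) :* (b :* a :- C)) refl

Riccati-split : ∀ {b C f} → b * f 0 ≡ C → f 1 ≡ 0ℚ → cst b ⊛ f ≗ cst C ⊕ X ⊛ (X ⊛ (b ∙ tail (tail f)))
Riccati-split {b} {C} {f} bf0≡C f1≡0 zero =
  trans bf0≡C (sym (trans (cong (C +_) (X⊛-zero (X ⊛ (b ∙ tail (tail f))))) (ℚP.+-identityʳ C)))
Riccati-split {b} {C} {f} bf0≡C f1≡0 (suc zero) =
  trans (cst⊛ b f 1) (trans (trans (cong (b *_) f1≡0) (ℚP.*-zeroʳ b))
    (sym (trans (cong (0ℚ +_) (trans (X⊛-suc (X ⊛ (b ∙ tail (tail f))) 0) (X⊛-zero (b ∙ tail (tail f)))))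
                (ℚP.+-identityʳ 0ℚ))))
Riccati-split {b} {C} {f} bf0≡C f1≡0 (suc (suc n)) =
  trans (cst⊛ b f (suc (suc n)))
    (sym (trans (cong (0ℚ +_) (trans (X⊛-suc (X ⊛ (b ∙ tail (tail f))) (suc n)) (X⊛-suc (b ∙ tail (tail f)) n)))
                (ℚP.+-identityˡ (b * f (suc (suc n))))))

≗⇒difference≗cst0 : ∀ {f g} → f ≗ g → f ⊕ ⊖ g ≗ cst 0ℚ
≗⇒difference≗cst0 f≗g = R.trans (x≈y⇒x∙y⁻¹≈ε f≗g) (R.sym cst0≗𝟘)

-- What is left of the Riccati equation for f after substituting b f = C + X²h and dividing by X².
ReducedDefect : ℚ → ℚ → ℚ → Series → Series
ReducedDefect b C W h = cst (ℕtoℚ 9) ⊛ cst C ⊕ ⊖ (cst W ⊛ cst b) ⊕ ⊖ ((cst C ⊕ cst 1ℚ) ⊛ h)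
                        ⊕ ⊖ (X ⊛ X ⊛ (h ⊛ h)) ⊕ ⊖ (1+9X² ⊛ (h ⊕ δ h))

Riccati⇒reduced : ∀ {b C W f h} → Riccati b C W f → cst b ⊛ f ≗ cst C ⊕ X ⊛ (X ⊛ h) → ReducedDefect b C W h ≗ 𝟘
Riccati⇒reduced {b} {C} {W} {f} {h} ric split = X⊛f≗𝟘⇒f≗𝟘 (X⊛f≗𝟘⇒f≗𝟘 (begin
  X ⊛ (X ⊛ ReducedDefect b C W h)
    ≈⟨ identity f (δ f) h (δ h) X (cst b) (cst C) (cst W) ⟩
  cst b ⊛ riccatiDefect ⊕ (⊖ splitDefect) ⊛ Y ⊕ ⊖ (1+9X² ⊛ (⊖ δsplitDefect ⊕ cst (ℕtoℚ 2) ⊛ splitDefect))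
    ≈⟨ R.+-cong (R.+-cong (R.*-cong (R.refl {cst b}) (≗⇒difference≗cst0 ric′))
                          (R.*-cong (R.-‿cong (≗⇒difference≗cst0 split)) (R.refl {Y})))
                (R.-‿cong (R.*-cong (R.refl {1+9X²}) (R.+-cong (R.-‿cong (≗⇒difference≗cst0 δsplit))
                                                           (R.*-cong (R.refl {cst (ℕtoℚ 2)}) (≗⇒difference≗cst0 split))))) ⟩
  cst b ⊛ cst 0ℚ ⊕ (⊖ cst 0ℚ) ⊛ Y ⊕ ⊖ (1+9X² ⊛ (⊖ cst 0ℚ ⊕ cst (ℕtoℚ 2) ⊛ cst 0ℚ))
    ≈⟨ solve-series 3 (λ b y l → b :⊛ :cst 0ℚ :⊕ (:⊖ :cst 0ℚ) :⊛ y :⊕ :⊖ (l :⊛ (:⊖ :cst 0ℚ :⊕ :cst (ℕtoℚ 2) :⊛ :cst 0ℚ))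
                                 :≗ :cst 0ℚ) R.refl (cst b) Y 1+9X² ⟩
  cst 0ℚ
    ≈⟨ cst0≗𝟘 ⟩
  𝟘 ∎))
  where
  open ≗-Reasoning
  ric′ : 1+9X² ⊛ (f ⊕ ⊖ δ f) ≗ cst b ⊛ (f ⊛ f) ⊕ (cst 1ℚ ⊕ ⊖ cst C) ⊛ f ⊕ cst W ⊛ (X ⊛ X)
  ric′ = R.trans ric (R.+-cong (R.+-cong (R.refl {cst b ⊛ (f ⊛ f)})
           (⊛-cong (R.trans (+-homo 1ℚ (- C)) (R.+-cong (R.refl {cst 1ℚ}) (-‿homo C))) (R.refl {f})))
           (R.refl {cst W ⊛ (X ⊛ X)}))
  δsplit : cst b ⊛ δ f ≗ X ⊛ (X ⊛ h) ⊕ X ⊛ (X ⊛ h ⊕ X ⊛ δ h)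
  δsplit = R.trans (R.sym (cst⊛-derivative b (R.refl {δ f})))
           (R.trans (δ-cong split)
           (R.trans (⊕-derivative (δ-cst C) (⊛-derivative δ-X (⊛-derivative δ-X (R.refl {δ h}))))
                    (R.+-identityˡ _)))
  riccatiDefect = 1+9X² ⊛ (f ⊕ ⊖ δ f) ⊕ ⊖ (cst b ⊛ (f ⊛ f) ⊕ (cst 1ℚ ⊕ ⊖ cst C) ⊛ f ⊕ cst W ⊛ (X ⊛ X))
  splitDefect = cst b ⊛ f ⊕ ⊖ (cst C ⊕ X ⊛ (X ⊛ h))
  δsplitDefect = cst b ⊛ δ f ⊕ ⊖ (X ⊛ (X ⊛ h) ⊕ X ⊛ (X ⊛ h ⊕ X ⊛ δ h))
  Y = ⊖ (cst C ⊕ cst 1ℚ) ⊕ splitDefect ⊕ ⊖ (cst (ℕtoℚ 2) ⊛ (cst b ⊛ f ⊕ ⊖ cst C)) ⊕ ⊖ 1+9X²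
  identity = solve-series 8 (λ f D h Dh x b C W →
    x :⊛ (x :⊛ (:cst (ℕtoℚ 9) :⊛ C :⊕ :⊖ (W :⊛ b) :⊕ :⊖ ((C :⊕ :cst 1ℚ) :⊛ h) :⊕ :⊖ (x :⊛ x :⊛ (h :⊛ h))
                 :⊕ :⊖ ((:cst 1ℚ :⊕ :cst (ℕtoℚ 9) :⊛ (x :⊛ x)) :⊛ (h :⊕ Dh))))
    :≗ b :⊛ ((:cst 1ℚ :⊕ :cst (ℕtoℚ 9) :⊛ (x :⊛ x)) :⊛ (f :⊕ :⊖ D)
             :⊕ :⊖ (b :⊛ (f :⊛ f) :⊕ (:cst 1ℚ :⊕ :⊖ C) :⊛ f :⊕ W :⊛ (x :⊛ x)))
      :⊕ (:⊖ (b :⊛ f :⊕ :⊖ (C :⊕ x :⊛ (x :⊛ h)))) :⊛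
          (:⊖ (C :⊕ :cst 1ℚ) :⊕ (b :⊛ f :⊕ :⊖ (C :⊕ x :⊛ (x :⊛ h))) :⊕ :⊖ (:cst (ℕtoℚ 2) :⊛ (b :⊛ f :⊕ :⊖ C))
            :⊕ :⊖ (:cst 1ℚ :⊕ :cst (ℕtoℚ 9) :⊛ (x :⊛ x)))
      :⊕ :⊖ ((:cst 1ℚ :⊕ :cst (ℕtoℚ 9) :⊛ (x :⊛ x)) :⊛
               (:⊖ (b :⊛ D :⊕ :⊖ (x :⊛ (x :⊛ h) :⊕ x :⊛ (x :⊛ h :⊕ x :⊛ Dh)))
                :⊕ :cst (ℕtoℚ 2) :⊛ (b :⊛ f :⊕ :⊖ (C :⊕ x :⊛ (x :⊛ h)))))) R.refl

-- Since δ g = - g² δ h, the reduced equation for h is a Riccati equation for g = 1/h.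
reduced⇒Riccati : ∀ {b C W h g} → ReducedDefect b C W h ≗ 𝟘 → h ⊛ g ≗ cst 1ℚ →
                  Riccati (ℕtoℚ 9 * C - W * b) (C + ℕtoℚ 2) (- 1ℚ) g
reduced⇒Riccati {b} {C} {W} {h} {g} reduced hg≗1 = R.trans (x∙y⁻¹≈ε⇒x≈y _ _ (begin
  1+9X² ⊛ (g ⊕ ⊖ δ g) ⊕ ⊖ rhs
    ≈⟨ identity g (δ g) h (δ h) X (cst b) (cst C) (cst W) ⟩
  ⊖ ((g ⊛ g) ⊛ ReducedDefect b C W h) ⊕ (cst 1ℚ ⊕ ⊖ (h ⊛ g)) ⊛ Q ⊕ ⊖ (1+9X² ⊛ g ⊛ (δ h ⊛ g ⊕ h ⊛ δ g))
    ≈⟨ R.+-cong (R.+-cong (R.-‿cong (R.*-cong (R.refl {g ⊛ g}) (R.trans reduced (R.sym cst0≗𝟘))))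
                          (R.*-cong (≗⇒difference≗cst0 (R.sym hg≗1)) (R.refl {Q})))
                (R.-‿cong (R.*-cong (R.refl {1+9X² ⊛ g}) δ[hg]≗0)) ⟩
  ⊖ ((g ⊛ g) ⊛ cst 0ℚ) ⊕ cst 0ℚ ⊛ Q ⊕ ⊖ (1+9X² ⊛ g ⊛ cst 0ℚ)
    ≈⟨ solve-series 3 (λ gg q lg → :⊖ (gg :⊛ :cst 0ℚ) :⊕ :cst 0ℚ :⊛ q :⊕ :⊖ (lg :⊛ :cst 0ℚ) :≗ :cst 0ℚ)
                      R.refl (g ⊛ g) Q (1+9X² ⊛ g) ⟩
  cst 0ℚ
    ≈⟨ cst0≗𝟘 ⟩
  𝟘 ∎)) (R.sym rhs-expansion)
  where
  open ≗-Reasoning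
  rhs = (cst (ℕtoℚ 9) ⊛ cst C ⊕ ⊖ (cst W ⊛ cst b)) ⊛ (g ⊛ g) ⊕ (cst 1ℚ ⊕ ⊖ (cst C ⊕ cst (ℕtoℚ 2))) ⊛ g
        ⊕ cst (- 1ℚ) ⊛ (X ⊛ X)
  Q = 1+9X² ⊛ g ⊕ ⊖ (1+9X² ⊛ δ g) ⊕ (cst C ⊕ cst 1ℚ) ⊛ g ⊕ X ⊛ X ⊛ (cst 1ℚ ⊕ h ⊛ g)
  δ[hg]≗0 : δ h ⊛ g ⊕ h ⊛ δ g ≗ cst 0ℚ
  δ[hg]≗0 = R.trans (R.sym (δ-⊛ h g)) (R.trans (δ-cong hg≗1) (R.trans (δ-cst 1ℚ) (R.sym cst0≗𝟘)))
  rhs-expansion : cst (ℕtoℚ 9 * C - W * b) ⊛ (g ⊛ g) ⊕ cst (1ℚ - (C + ℕtoℚ 2)) ⊛ g ⊕ cst (- 1ℚ) ⊛ (X ⊛ X) ≗ rhs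
  rhs-expansion = R.+-cong (R.+-cong (⊛-cong b′ (R.refl {g ⊛ g})) (⊛-cong u′ (R.refl {g}))) (R.refl {cst (- 1ℚ) ⊛ (X ⊛ X)})
    where
    b′ : cst (ℕtoℚ 9 * C - W * b) ≗ cst (ℕtoℚ 9) ⊛ cst C ⊕ ⊖ (cst W ⊛ cst b)
    b′ = R.trans (+-homo (ℕtoℚ 9 * C) (- (W * b))) (R.+-cong (*-homo (ℕtoℚ 9) C) (R.trans (-‿homo (W * b)) (R.-‿cong (*-homo W b))))
    u′ : cst (1ℚ - (C + ℕtoℚ 2)) ≗ cst 1ℚ ⊕ ⊖ (cst C ⊕ cst (ℕtoℚ 2))
    u′ = R.trans (+-homo 1ℚ (- (C + ℕtoℚ 2))) (R.+-cong (R.refl {cst 1ℚ}) (R.trans (-‿homo (C + ℕtoℚ 2)) (R.-‿cong (+-homo C (ℕtoℚ 2)))))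
  identity = solve-series 8 (λ g Dg h Dh x b C W →
    (:cst 1ℚ :⊕ :cst (ℕtoℚ 9) :⊛ (x :⊛ x)) :⊛ (g :⊕ :⊖ Dg)
      :⊕ :⊖ ((:cst (ℕtoℚ 9) :⊛ C :⊕ :⊖ (W :⊛ b)) :⊛ (g :⊛ g) :⊕ (:cst 1ℚ :⊕ :⊖ (C :⊕ :cst (ℕtoℚ 2))) :⊛ g
             :⊕ :cst (- 1ℚ) :⊛ (x :⊛ x))
    :≗ :⊖ ((g :⊛ g) :⊛ (:cst (ℕtoℚ 9) :⊛ C :⊕ :⊖ (W :⊛ b) :⊕ :⊖ ((C :⊕ :cst 1ℚ) :⊛ h) :⊕ :⊖ (x :⊛ x :⊛ (h :⊛ h))
                         :⊕ :⊖ ((:cst 1ℚ :⊕ :cst (ℕtoℚ 9) :⊛ (x :⊛ x)) :⊛ (h :⊕ Dh))))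
      :⊕ (:cst 1ℚ :⊕ :⊖ (h :⊛ g)) :⊛ ((:cst 1ℚ :⊕ :cst (ℕtoℚ 9) :⊛ (x :⊛ x)) :⊛ g
             :⊕ :⊖ ((:cst 1ℚ :⊕ :cst (ℕtoℚ 9) :⊛ (x :⊛ x)) :⊛ Dg) :⊕ (C :⊕ :cst 1ℚ) :⊛ g :⊕ x :⊛ x :⊛ (:cst 1ℚ :⊕ h :⊛ g))
      :⊕ :⊖ ((:cst 1ℚ :⊕ :cst (ℕtoℚ 9) :⊛ (x :⊛ x)) :⊛ g :⊛ (Dh :⊛ g :⊕ h :⊛ Dg))) R.refl

-- For x = t·f(1/t) the split reads b x − C t = t⁻¹·remainder(1/t), and the next complete quotient
-- 1/(b x − C t) is t·reciprocal(1/t).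
record RiccatiStep (b C W : ℚ) (f : Series) : Set where
  field
    remainder          : Series
    split              : cst b ⊛ f ≗ cst C ⊕ X ⊛ (X ⊛ remainder)
    remainder-const≢0  : remainder 0 ≢ 0ℚ
    reciprocal         : Series
    reciprocal-inverse : remainder ⊛ reciprocal ≗ cst 1ℚ
    reciprocal-Riccati : Riccati (ℕtoℚ 9 * C - W * b) (C + ℕtoℚ 2) (- 1ℚ) reciprocal

riccati-step : ∀ {b C W f} → Riccati b C W f → f 0 ≢ 0ℚ → C + 1ℚ ≢ 0ℚ → ℕtoℚ 9 * C - W * b ≢ 0ℚ →
               RiccatiStep b C W f
riccati-step {b} {C} {W} {f} ric f0≢0 C+1≢0 b′≢0 = record
  { remainder          = h
  ; split              = split
  ; remainder-const≢0  = h0≢0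
  ; reciprocal         = proj₁ inverse
  ; reciprocal-inverse = proj₂ inverse
  ; reciprocal-Riccati = reduced⇒Riccati (Riccati⇒reduced ric split) (proj₂ inverse)
  }
  where
  bf0≡C = Riccati-const {b} {C} {W} {f} ric f0≢0
  f1≡0  = Riccati-linear {b} {C} {W} {f} ric bf0≡C C+1≢0
  h     = b ∙ tail (tail f)
  split = Riccati-split bf0≡C f1≡0
  h0≢0 : h 0 ≢ 0ℚ
  h0≢0 h0≡0 = b′≢0 (begin
    ℕtoℚ 9 * C - W * b         ≡⟨ sym (Riccati-quadratic {b} {C} {W} {f} ric bf0≡C f1≡0) ⟩
    (C + ℕtoℚ 2) * (b * f 2)   ≡⟨ cong ((C + ℕtoℚ 2) *_) h0≡0 ⟩
    (C + ℕtoℚ 2) * 0ℚ          ≡⟨ ℚP.*-zeroʳ (C + ℕtoℚ 2) ⟩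
    0ℚ                         ∎)
    where open ≡-Reasoning
  inverse = ⊛-inverse h h0≢0

-- The i-th complete quotient satisfies the Riccati equation with (βseq i, Cseq i, Wseq i); aᵢ = Cseq i · t.
Cseq : ℕ → ℚ
Cseq i = ℕtoℚ (2 ℕ.* i ℕ.+ 1)

Wseq : ℕ → ℚ
Wseq zero    = 1ℚ
Wseq (suc _) = - 1ℚ

Cseq-suc : ∀ i → Cseq i + ℕtoℚ 2 ≡ Cseq (suc i)
Cseq-suc i = trans (sym (ℕtoℚ-+ (2 ℕ.* i ℕ.+ 1) 2)) (cong ℕtoℚ (2i+1+2≡2[1+i]+1 i))
  where
  2i+1+2≡2[1+i]+1 : ∀ i → 2 ℕ.* i ℕ.+ 1 ℕ.+ 2 ≡ 2 ℕ.* suc i ℕ.+ 1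
  2i+1+2≡2[1+i]+1 = ℕ-solve-∀

Cseq+1≢0 : ∀ i → Cseq i + 1ℚ ≢ 0ℚ
Cseq+1≢0 i eq with ℕP.m+n≡0⇒n≡0 (2 ℕ.* i ℕ.+ 1) (ℕtoℚ-injective {n = 0} (trans (ℕtoℚ-+ (2 ℕ.* i ℕ.+ 1) 1) eq))
... | ()

3[1+k]∸1≡2+3k : ∀ k → 3 ℕ.* suc k ℕ.∸ 1 ≡ 2 ℕ.+ 3 ℕ.* k
3[1+k]∸1≡2+3k k = cong (ℕ._∸ 1) (ℕP.*-suc 3 k)

βseq-suc≡ : ∀ k → βseq (suc k) ≡ ℕtoℚ ((2 ℕ.+ 3 ℕ.* k) ℕ.* (3 ℕ.* suc k ℕ.+ 1))
βseq-suc≡ k = cong (λ m → ℕtoℚ (m ℕ.* (3 ℕ.* suc k ℕ.+ 1))) (3[1+k]∸1≡2+3k k)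

βseq-suc≢0 : ∀ k → βseq (suc k) ≢ 0ℚ
βseq-suc≢0 k eq with ℕtoℚ-injective {m = (2 ℕ.+ 3 ℕ.* k) ℕ.* (3 ℕ.* suc k ℕ.+ 1)} {n = 0} (trans (sym (βseq-suc≡ k)) eq)
... | ()

-- (3k+2)(3k+4) = 9(2k+1) + (3k−1)(3k+1), and 8 = 9·1 − 1·1.
βseq-recurrence : ∀ i → ℕtoℚ 9 * Cseq i - Wseq i * βseq i ≡ βseq (suc i)
βseq-recurrence zero    = refl
βseq-recurrence (suc k) = begin
  ℕtoℚ 9 * Cseq (suc k) - (- 1ℚ) * βseq (suc k)
    ≡⟨ solve 3 (λ a x y → a :* x :- (:- con 1ℚ) :* y := a :* x :+ y) refl (ℕtoℚ 9) (Cseq (suc k)) (βseq (suc k)) ⟩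
  ℕtoℚ 9 * Cseq (suc k) + βseq (suc k)
    ≡⟨ cong₂ _+_ (sym (ℕtoℚ-* 9 (2 ℕ.* suc k ℕ.+ 1))) (βseq-suc≡ k) ⟩
  ℕtoℚ (9 ℕ.* (2 ℕ.* suc k ℕ.+ 1)) + ℕtoℚ ((2 ℕ.+ 3 ℕ.* k) ℕ.* (3 ℕ.* suc k ℕ.+ 1))
    ≡⟨ sym (ℕtoℚ-+ (9 ℕ.* (2 ℕ.* suc k ℕ.+ 1)) _) ⟩
  ℕtoℚ (9 ℕ.* (2 ℕ.* suc k ℕ.+ 1) ℕ.+ (2 ℕ.+ 3 ℕ.* k) ℕ.* (3 ℕ.* suc k ℕ.+ 1))
    ≡⟨ cong ℕtoℚ (product-identity k) ⟩
  ℕtoℚ ((2 ℕ.+ 3 ℕ.* suc k) ℕ.* (3 ℕ.* suc (suc k) ℕ.+ 1))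
    ≡⟨ sym (βseq-suc≡ (suc k)) ⟩
  βseq (suc (suc k)) ∎
  where
  open ≡-Reasoning
  product-identity : ∀ k → 9 ℕ.* (2 ℕ.* suc k ℕ.+ 1) ℕ.+ (2 ℕ.+ 3 ℕ.* k) ℕ.* (3 ℕ.* suc k ℕ.+ 1)
                           ≡ (2 ℕ.+ 3 ℕ.* suc k) ℕ.* (3 ℕ.* suc (suc k) ℕ.+ 1)
  product-identity = ℕ-solve-∀

RiccatiSolution : ℕ → Set
RiccatiSolution i = Σ Series λ f → Riccati (βseq i) (Cseq i) (Wseq i) f × f 0 ≢ 0ℚ

riccatiSolution-step : ∀ i (s : RiccatiSolution i) → RiccatiStep (βseq i) (Cseq i) (Wseq i) (proj₁ s)
riccatiSolution-step i (f , ric , f0≢0) =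
  riccati-step ric f0≢0 (Cseq+1≢0 i) (subst (_≢ 0ℚ) (sym (βseq-recurrence i)) (βseq-suc≢0 i))

f₀-const≢0 : f₀ 0 ≢ 0ℚ
f₀-const≢0 eq = ℚP.1≢0 (trans (sym f₀-const) eq)

riccatiSolution : ∀ i → RiccatiSolution i
riccatiSolution zero    = f₀ , Riccati-f₀ , f₀-const≢0
riccatiSolution (suc i) =
  S.reciprocal ,
  subst₂ (λ b C → Riccati b C (- 1ℚ) S.reciprocal) (βseq-recurrence i) (Cseq-suc i) S.reciprocal-Riccati ,
  ⊛≗1⇒const≢0 S.reciprocal-inverse
  where module S = RiccatiStep (riccatiSolution-step i (riccatiSolution i))

-- Laurent series as power series in t⁻¹

coeff-view : ∀ x e → (Σ ℕ λ j → (ℤ.+ top x ℤ.- e ≡ ℤ.+ j) × (coeff x e ≡ cf x j))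
                   ⊎ (Σ ℕ λ k → (ℤ.+ top x ℤ.- e ≡ -[1+ k ]) × (coeff x e ≡ 0ℚ))
coeff-view x e with ℤ.+ top x ℤ.- e
... | ℤ.+ j    = inj₁ (j , refl , refl)
... | -[1+ k ] = inj₂ (k , refl , refl)

m-[m-n]≡n : ∀ m n → m ℤ.- (m ℤ.- n) ≡ n
m-[m-n]≡n = ℤ-solve-∀

m-n≡-[1+k]⇒m<n : ∀ {m n k} → m ℤ.- n ≡ -[1+ k ] → m ℤ.< n
m-n≡-[1+k]⇒m<n {m} {n} eq = subst₂ ℤ._<_ (m-n+n≡m m n) (ℤP.+-identityˡ n)
  (ℤP.+-monoˡ-< n (subst (ℤ._< ℤ.+ 0) (sym eq) ℤ.-<+))
  where
  m-n+n≡m : ∀ m n → m ℤ.- n ℤ.+ n ≡ m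
  m-n+n≡m = ℤ-solve-∀

Bounded : ℕ → Laurent → Set
Bounded N x = ∀ e → ℤ.+ N ℤ.< e → coeff x e ≡ 0ℚ

Bounded-mono : ∀ {M N x} → M ℕ.≤ N → Bounded M x → Bounded N x
Bounded-mono M≤N bounded e N<e = bounded e (ℤP.≤-<-trans (ℤ.+≤+ M≤N) N<e)

top-bounded : ∀ {x N} → top x ℕ.≤ N → Bounded N x
top-bounded {x} {N} top≤N e N<e with coeff-view x e
... | inj₂ (_ , _ , coeff≡0) = coeff≡0
... | inj₁ (j , eq , _)      = ⊥-elim (ℤP.<-irrefl refl (ℤP.≤-<-trans e≤N N<e))
  where
  e≤N : e ℤ.≤ ℤ.+ N
  e≤N = subst (ℤ._≤ ℤ.+ N) (trans (cong (ℤ._-_ (ℤ.+ top x)) (sym eq)) (m-[m-n]≡n (ℤ.+ top x) e))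
              (ℤP.≤-trans (ℤP.i-j≤i (ℤ.+ top x) (ℤ.+ j)) (ℤ.+≤+ top≤N))

coeff-at : ∀ x e j → ℤ.+ top x ℤ.- e ≡ ℤ.+ j → coeff x e ≡ cf x j
coeff-at x e j eq with coeff-view x e
... | inj₁ (j′ , eq′ , coeff≡) = trans coeff≡ (cong (cf x) (ℤP.+-injective (trans (sym eq′) eq)))
... | inj₂ (k , eq′ , _) with trans (sym eq) eq′
...   | ()

-- toSeries N x = Σⱼ (coefficient of t^(N − j) in x) sʲ is the series in s = t⁻¹ of t^(−N)·x.
toSeries : ℕ → Laurent → Series
toSeries N x j = coeff x (ℤ.+ N ℤ.- ℤ.+ j)

toSeries-top : ∀ x → toSeries (top x) x ≗ cf x
toSeries-top x j = coeff-at x (ℤ.+ top x ℤ.- ℤ.+ j) j (m-[m-n]≡n (ℤ.+ top x) (ℤ.+ j))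

toSeries-suc : ∀ {N x} → Bounded N x → toSeries (suc N) x ≗ X ⊛ toSeries N x
toSeries-suc {N} {x} bounded zero =
  trans (bounded _ (ℤ.+<+ (s≤s (ℕP.m≤m+n N 0)))) (sym (X⊛-zero (toSeries N x)))
toSeries-suc {N} {x} bounded (suc j) =
  trans (cong (coeff x) (1+n-[1+j]≡n-j (ℤ.+ N) (ℤ.+ j))) (sym (X⊛-suc (toSeries N x) j))
  where
  1+n-[1+j]≡n-j : ∀ n j → (ℤ.+ 1 ℤ.+ n) ℤ.- (ℤ.+ 1 ℤ.+ j) ≡ n ℤ.- j
  1+n-[1+j]≡n-j = ℤ-solve-∀

coeff-+L : ∀ x y e → coeff (x +L y) e ≡ coeff x e + coeff y e
coeff-+L x y e with coeff-view (x +L y) e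
... | inj₁ (j , eq , coeff≡) = trans coeff≡ (sym (cong (λ z → coeff x z + coeff y z)
        (trans (sym (m-[m-n]≡n (ℤ.+ (top x ⊔ top y)) e)) (cong (ℤ._-_ (ℤ.+ (top x ⊔ top y))) eq))))
... | inj₂ (k , eq , coeff≡0) = trans coeff≡0 (sym (trans
        (cong₂ _+_ (top-bounded (ℕP.m≤m⊔n (top x) (top y)) e (m-n≡-[1+k]⇒m<n eq))
                   (top-bounded (ℕP.m≤n⊔m (top x) (top y)) e (m-n≡-[1+k]⇒m<n eq)))
        (ℚP.+-identityˡ 0ℚ)))

coeff-• : ∀ q x e → coeff (q • x) e ≡ q * coeff x e
coeff-• q x e with coeff-view (q • x) e | coeff-view x e
... | inj₁ (j , eq , coeff≡) | inj₁ (j′ , eq′ , coeff≡′) =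
  trans coeff≡ (cong (q *_) (sym (trans coeff≡′ (cong (cf x) (ℤP.+-injective (trans (sym eq′) eq))))))
... | inj₂ (k , eq , coeff≡0) | inj₂ (k′ , eq′ , coeff≡0′) =
  trans coeff≡0 (sym (trans (cong (q *_) coeff≡0′) (ℚP.*-zeroʳ q)))
... | inj₁ (j , eq , _) | inj₂ (k′ , eq′ , _) with trans (sym eq) eq′
...   | ()
coeff-• q x e | inj₂ (k , eq , _) | inj₁ (j′ , eq′ , _) with trans (sym eq) eq′
...   | ()

toSeries-+L : ∀ N x y → toSeries N (x +L y) ≗ toSeries N x ⊕ toSeries N y
toSeries-+L N x y j = coeff-+L x y (ℤ.+ N ℤ.- ℤ.+ j)

toSeries-• : ∀ N q x → toSeries N (q • x) ≗ cst q ⊛ toSeries N x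
toSeries-• N q x j = trans (coeff-• q x (ℤ.+ N ℤ.- ℤ.+ j)) (sym (cst⊛ q (toSeries N x) j))

X^ : ℕ → Series
X^ zero    = cst 1ℚ
X^ (suc k) = X ⊛ X^ k

X^-+ : ∀ a b → X^ (a ℕ.+ b) ≗ X^ a ⊛ X^ b
X^-+ zero    b = R.sym (R.*-identityˡ (X^ b))
X^-+ (suc a) b = R.trans (R.*-cong (R.refl {X}) (X^-+ a b)) (R.sym (R.*-assoc X (X^ a) (X^ b)))

X^-cancelˡ : ∀ k {f g} → X^ k ⊛ f ≗ X^ k ⊛ g → f ≗ g
X^-cancelˡ zero    {f} {g} eq = R.trans (R.sym (R.*-identityˡ f)) (R.trans eq (R.*-identityˡ g))
X^-cancelˡ (suc k) {f} {g} eq =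
  X^-cancelˡ k (X⊛-cancelˡ (R.trans (R.sym (R.*-assoc X (X^ k) f)) (R.trans eq (R.*-assoc X (X^ k) g))))

toSeries-+ : ∀ {N x} → Bounded N x → ∀ k → toSeries (k ℕ.+ N) x ≗ X^ k ⊛ toSeries N x
toSeries-+ {N} {x} bounded zero    = R.sym (R.*-identityˡ (toSeries N x))
toSeries-+ {N} {x} bounded (suc k) =
  R.trans (toSeries-suc (Bounded-mono (ℕP.m≤n+m N k) bounded))
  (R.trans (R.*-cong (R.refl {X}) (toSeries-+ bounded k)) (R.sym (R.*-assoc X (X^ k) (toSeries N x))))

toSeries≗X^⊛cf : ∀ x N → top x ℕ.≤ N → toSeries N x ≗ X^ (N ℕ.∸ top x) ⊛ cf x
toSeries≗X^⊛cf x N top≤N j = trans (cong (λ M → toSeries M x j) (sym (ℕP.m∸n+n≡m top≤N)))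
  (trans (toSeries-+ (top-bounded ℕP.≤-refl) (N ℕ.∸ top x) j)
         (⊛-cong (R.refl {X^ (N ℕ.∸ top x)}) (toSeries-top x) j))

cf-*L : ∀ x y → cf (x *L y) ≗ cf x ⊛ cf y
cf-*L x y n = trans (cong sumℚ (map-upTo (λ i → cf x i * cf y (n ℕ.∸ i)) (suc n))) (Cauchy-sum n (cf x) (cf y))
  where
  Cauchy-sum : ∀ n f g → sumℚ (applyUpTo (λ i → f i * g (n ℕ.∸ i)) (suc n)) ≡ (f ⊛ g) n
  Cauchy-sum zero    f g = ℚP.+-identityʳ (f 0 * g 0)
  Cauchy-sum (suc n) f g = cong (f 0 * g (suc n) +_) (Cauchy-sum n (tail f) g)

[m+n]∸[o+p]≡[m∸o]+[n∸p] : ∀ {m n o p} → o ℕ.≤ m → p ℕ.≤ n → m ℕ.+ n ℕ.∸ (o ℕ.+ p) ≡ (m ℕ.∸ o) ℕ.+ (n ℕ.∸ p)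
[m+n]∸[o+p]≡[m∸o]+[n∸p] {m} {n} {o} {p} o≤m p≤n = begin
  m ℕ.+ n ℕ.∸ (o ℕ.+ p)                                   ≡⟨ cong₂ (λ a b → a ℕ.+ b ℕ.∸ (o ℕ.+ p))
                                                                   (sym (ℕP.m∸n+n≡m o≤m)) (sym (ℕP.m∸n+n≡m p≤n)) ⟩
  (m ℕ.∸ o ℕ.+ o) ℕ.+ (n ℕ.∸ p ℕ.+ p) ℕ.∸ (o ℕ.+ p)       ≡⟨ cong (ℕ._∸ (o ℕ.+ p)) (ℕ+.interchange (m ℕ.∸ o) o (n ℕ.∸ p) p) ⟩
  (m ℕ.∸ o ℕ.+ (n ℕ.∸ p)) ℕ.+ (o ℕ.+ p) ℕ.∸ (o ℕ.+ p)     ≡⟨ ℕP.m+n∸n≡m _ (o ℕ.+ p) ⟩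
  (m ℕ.∸ o) ℕ.+ (n ℕ.∸ p)                                 ∎
  where open ≡-Reasoning

toSeries-*L : ∀ x y N M → top x ℕ.≤ N → top y ℕ.≤ M → toSeries (N ℕ.+ M) (x *L y) ≗ toSeries N x ⊛ toSeries M y
toSeries-*L x y N M top≤N top≤M = begin
  toSeries (N ℕ.+ M) (x *L y)                  ≈⟨ toSeries≗X^⊛cf (x *L y) (N ℕ.+ M) (ℕP.+-mono-≤ top≤N top≤M) ⟩
  X^ (N ℕ.+ M ℕ.∸ (top x ℕ.+ top y)) ⊛ cf (x *L y)
    ≈⟨ ⊛-cong (λ j → cong (λ k → X^ k j) ([m+n]∸[o+p]≡[m∸o]+[n∸p] top≤N top≤M)) (cf-*L x y) ⟩
  X^ (a ℕ.+ b) ⊛ (cf x ⊛ cf y)                 ≈⟨ ⊛-cong (X^-+ a b) (R.refl {cf x ⊛ cf y}) ⟩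
  (X^ a ⊛ X^ b) ⊛ (cf x ⊛ cf y)                ≈⟨ solve-series 4 (λ p q u v → (p :⊛ q) :⊛ (u :⊛ v) :≗ (p :⊛ u) :⊛ (q :⊛ v))
                                                                 R.refl (X^ a) (X^ b) (cf x) (cf y) ⟩
  (X^ a ⊛ cf x) ⊛ (X^ b ⊛ cf y)                ≈⟨ R.sym (⊛-cong (toSeries≗X^⊛cf x N top≤N) (toSeries≗X^⊛cf y M top≤M)) ⟩
  toSeries N x ⊛ toSeries M y                  ∎
  where
  open ≗-Reasoning
  a = N ℕ.∸ top x
  b = M ℕ.∸ top y

toSeries-injective : ∀ x y N → top x ℕ.≤ N → top y ℕ.≤ N → toSeries N x ≗ toSeries N y → x ≈ y
toSeries-injective x y N topx≤N topy≤N eq e with ℤ.+ N ℤ.- e in N-e≡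
... | ℤ.+ j      = trans (cong (coeff x) (sym e≡)) (trans (eq j) (cong (coeff y) e≡))
  where
  e≡ : ℤ.+ N ℤ.- ℤ.+ j ≡ e
  e≡ = trans (cong (ℤ._-_ (ℤ.+ N)) (sym N-e≡)) (m-[m-n]≡n (ℤ.+ N) e)
... | -[1+ k ] = trans (top-bounded topx≤N e (m-n≡-[1+k]⇒m<n N-e≡)) (sym (top-bounded topy≤N e (m-n≡-[1+k]⇒m<n N-e≡)))

-- The root and its continued fraction

cf-tL : cf tL ≗ cst 1ℚ
cf-tL zero    = refl
cf-tL (suc n) = refl

toSeries-tL : ∀ M → toSeries (suc M) tL ≗ X^ M
toSeries-tL M = R.trans (toSeries≗X^⊛cf tL (suc M) (s≤s z≤n)) (R.trans (⊛-cong (R.refl {X^ M}) cf-tL) (R.*-identityʳ (X^ M)))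

-- The series of t^(−3T)·P(y) in terms of those of t^(−T)·y, t^(−T)·t, t^(−3T)·y and t^(−3T)·t.
Pˢ : Series → Series → Series → Series → Series
Pˢ φ τ φ₃ τ₃ = ((cst (ℕtoℚ 3) ⊛ ((φ ⊛ φ) ⊛ φ) ⊕ cst (- 1ℚ) ⊛ (cst (ℕtoℚ 3) ⊛ ((τ ⊛ φ) ⊛ φ)))
                ⊕ cst (- 1ℚ) ⊛ (cst (ℕtoℚ 9) ⊛ φ₃)) ⊕ τ₃

toSeries-P : ∀ y T → top y ℕ.≤ T → 1 ℕ.≤ T →
             toSeries (T ℕ.+ T ℕ.+ T) (P y) ≗ Pˢ (toSeries T y) (toSeries T tL) (toSeries (T ℕ.+ T ℕ.+ T) y) (toSeries (T ℕ.+ T ℕ.+ T) tL)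
toSeries-P y T top≤T 1≤T =
  R.trans (toSeries-+L N _ tL)
  (R.+-cong (R.trans (toSeries-+L N _ _)
    (R.+-cong (R.trans (toSeries-+L N _ _)
       (R.+-cong (R.trans (toSeries-• N (ℕtoℚ 3) (y *L y *L y)) (⊛-cong (R.refl {cst (ℕtoℚ 3)}) y³))
                 (R.trans (toSeries-• N (- 1ℚ) (ℕtoℚ 3 • (tL *L y *L y))) (⊛-cong (R.refl {cst (- 1ℚ)})
                    (R.trans (toSeries-• N (ℕtoℚ 3) (tL *L y *L y)) (⊛-cong (R.refl {cst (ℕtoℚ 3)}) ty²))))))
       (R.trans (toSeries-• N (- 1ℚ) (ℕtoℚ 9 • y)) (⊛-cong (R.refl {cst (- 1ℚ)}) (toSeries-• N (ℕtoℚ 9) y)))))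
    (R.refl {toSeries N tL}))
  where
  N = T ℕ.+ T ℕ.+ T
  y³ : toSeries N (y *L y *L y) ≗ (toSeries T y ⊛ toSeries T y) ⊛ toSeries T y
  y³ = R.trans (toSeries-*L (y *L y) y (T ℕ.+ T) T (ℕP.+-mono-≤ top≤T top≤T) top≤T)
               (⊛-cong (toSeries-*L y y T T top≤T top≤T) (R.refl {toSeries T y}))
  ty² : toSeries N (tL *L y *L y) ≗ (toSeries T tL ⊛ toSeries T y) ⊛ toSeries T y
  ty² = R.trans (toSeries-*L (tL *L y) y (T ℕ.+ T) T (ℕP.+-mono-≤ 1≤T top≤T) top≤T)
                (⊛-cong (toSeries-*L tL y T T 1≤T top≤T) (R.refl {toSeries T y}))

toSeries-0L : ∀ N → toSeries N 0L ≗ 𝟘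
toSeries-0L N j with ℤ.+ 0 ℤ.- (ℤ.+ N ℤ.- ℤ.+ j)
... | ℤ.+ zero    = refl
... | ℤ.+ (suc _) = refl
... | -[1+ _ ]    = refl

x₀ : Laurent
x₀ = mkL 1 f₀

P-x₀ : P x₀ ≈ 0L
P-x₀ = toSeries-injective (P x₀) 0L 3 ℕP.≤-refl z≤n (begin
  toSeries 3 (P x₀)                                   ≈⟨ toSeries-P x₀ 1 ℕP.≤-refl ℕP.≤-refl ⟩
  Pˢ (toSeries 1 x₀) (toSeries 1 tL) (toSeries 3 x₀) (toSeries 3 tL)
    ≈⟨ R.+-cong (R.+-cong (R.+-cong (⊛-cong (R.refl {cst (ℕtoℚ 3)}) (⊛-cong (⊛-cong φ≗ φ≗) φ≗))
                                     (⊛-cong (R.refl {cst (- 1ℚ)}) (⊛-cong (R.refl {cst (ℕtoℚ 3)}) (⊛-cong (⊛-cong τ≗ φ≗) φ≗))))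
                           (⊛-cong (R.refl {cst (- 1ℚ)}) (⊛-cong (R.refl {cst (ℕtoℚ 9)}) φ₃≗)))
                 (toSeries-tL 2) ⟩
  Pˢ f₀ (cst 1ℚ) (X^ 2 ⊛ f₀) (X^ 2)                    ≈⟨ Pˢ-f₀ ⟩
  Cubic f₀                                            ≈⟨ Cubic-f₀ ⟩
  𝟘                                                   ≈⟨ R.sym (toSeries-0L 3) ⟩
  toSeries 3 0L                                       ∎)
  where
  open ≗-Reasoning
  φ≗ : toSeries 1 x₀ ≗ f₀
  φ≗ = toSeries-top x₀
  τ≗ : toSeries 1 tL ≗ cst 1ℚ
  τ≗ = toSeries-tL 0
  φ₃≗ : toSeries 3 x₀ ≗ X^ 2 ⊛ f₀
  φ₃≗ = toSeries≗X^⊛cf x₀ 3 (s≤s z≤n)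
  Pˢ-f₀ : Pˢ f₀ (cst 1ℚ) (X^ 2 ⊛ f₀) (X^ 2) ≗ Cubic f₀
  Pˢ-f₀ = solve-series 2 (λ f x →
    ((:cst (ℕtoℚ 3) :⊛ ((f :⊛ f) :⊛ f) :⊕ :cst (- 1ℚ) :⊛ (:cst (ℕtoℚ 3) :⊛ ((:cst 1ℚ :⊛ f) :⊛ f)))
      :⊕ :cst (- 1ℚ) :⊛ (:cst (ℕtoℚ 9) :⊛ ((x :⊛ (x :⊛ :cst 1ℚ)) :⊛ f))) :⊕ x :⊛ (x :⊛ :cst 1ℚ)
    :≗ :cst (ℕtoℚ 3) :⊛ (f :⊛ f :⊛ f) :⊕ :⊖ (:cst (ℕtoℚ 3) :⊛ (f :⊛ f)) :⊕ :⊖ (:cst (ℕtoℚ 9) :⊛ (x :⊛ x :⊛ f)) :⊕ x :⊛ x)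
    R.refl f₀ X

DegPos-x₀ : DegPos x₀
DegPos-x₀ = ℤ.+ 1 , (leading , above) , ℤ.+<+ (s≤s z≤n)
  where
  leading : coeff x₀ (ℤ.+ 1) ≢ 0ℚ
  leading eq = ℚP.1≢0 (trans (sym f₀-const) eq)
  above : ∀ e → ℤ.+ 1 ℤ.< e → coeff x₀ e ≡ 0ℚ
  above = top-bounded ℕP.≤-refl

toSeries-≡ : ∀ {M M′} x → M ≡ M′ → toSeries M x ≗ toSeries M′ x
toSeries-≡ x refl = R.refl

toSeries-leading≢0 : ∀ {y d} → HasDegree y (ℤ.+ d) → toSeries d y 0 ≢ 0ℚ
toSeries-leading≢0 {y} {d} (leading , _) eq = leading (trans (cong (coeff y) (sym (ℤP.+-identityʳ (ℤ.+ d)))) eq)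

-- The series of t^(−3d)·P(t^d·ψ(1/t)) for d = n + 1.
Cubicᵈ : ℕ → Series → Series
Cubicᵈ n ψ = cst (ℕtoℚ 3) ⊛ (ψ ⊛ ψ ⊛ ψ) ⊕ ⊖ (cst (ℕtoℚ 3) ⊛ (X^ n ⊛ ψ ⊛ ψ)) ⊕ ⊖ (cst (ℕtoℚ 9) ⊛ (X^ (suc n ℕ.+ suc n) ⊛ ψ))
             ⊕ X^ (2 ℕ.+ (n ℕ.+ n ℕ.+ n))

degree≤top : ∀ {y d} → HasDegree y (ℤ.+ d) → d ℕ.≤ top y
degree≤top {y} {d} (leading , _) with d ℕ.≤? top y
... | yes d≤top = d≤top
... | no  d≰top = ⊥-elim (leading (top-bounded ℕP.≤-refl (ℤ.+ d) (ℤ.+<+ (ℕP.≰⇒> d≰top))))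

-- Writing top y = k + d, every series in the computation of P y at level 3·top y carries the factor X^k.
P-root⇒Cubicᵈ : ∀ y n → P y ≈ 0L → HasDegree y (ℤ.+ suc n) → Cubicᵈ n (toSeries (suc n) y) ≗ 𝟘
P-root⇒Cubicᵈ y n Py≈0 degree = X^-cancelˡ (k ℕ.+ k ℕ.+ k) (begin
  X^ (k ℕ.+ k ℕ.+ k) ⊛ Cubicᵈ n ψ
    ≈⟨ ⊛-cong (X^-3 k) (R.refl {Cubicᵈ n ψ}) ⟩
  Y ⊛ Y ⊛ Y ⊛ Cubicᵈ n ψ
    ≈⟨ R.sym (factorisation Y ψ (X^ n) (X^ (d ℕ.+ d)) (X^ (2 ℕ.+ (n ℕ.+ n ℕ.+ n)))) ⟩
  Pˢ (Y ⊛ ψ) (Y ⊛ X^ n) (Y ⊛ Y ⊛ Y ⊛ X^ (d ℕ.+ d) ⊛ ψ) (Y ⊛ Y ⊛ Y ⊛ X^ (2 ℕ.+ (n ℕ.+ n ℕ.+ n)))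
    ≈⟨ R.sym (R.+-cong (R.+-cong (R.+-cong (⊛-cong (R.refl {cst (ℕtoℚ 3)}) (⊛-cong (⊛-cong φ≗ φ≗) φ≗))
                                           (⊛-cong (R.refl {cst (- 1ℚ)}) (⊛-cong (R.refl {cst (ℕtoℚ 3)}) (⊛-cong (⊛-cong τ≗ φ≗) φ≗))))
                                 (⊛-cong (R.refl {cst (- 1ℚ)}) (⊛-cong (R.refl {cst (ℕtoℚ 9)}) φ₃≗)))
                       τ₃≗) ⟩
  Pˢ (toSeries T y) (toSeries T tL) (toSeries N y) (toSeries N tL)
    ≈⟨ R.sym (toSeries-P y T ℕP.≤-refl (ℕP.≤-trans (s≤s z≤n) d≤T)) ⟩
  toSeries N (P y)
    ≈⟨ (λ j → trans (Py≈0 (ℤ.+ N ℤ.- ℤ.+ j)) (toSeries-0L N j)) ⟩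
  𝟘
    ≈⟨ R.sym (R.zeroʳ (X^ (k ℕ.+ k ℕ.+ k))) ⟩
  X^ (k ℕ.+ k ℕ.+ k) ⊛ 𝟘 ∎)
  where
  open ≗-Reasoning
  d = suc n
  T = top y
  N = T ℕ.+ T ℕ.+ T
  d≤T = degree≤top degree
  k = T ℕ.∸ d
  Y = X^ k
  ψ = toSeries d y
  T≡k+d : T ≡ k ℕ.+ d
  T≡k+d = sym (ℕP.m∸n+n≡m d≤T)
  X^-3 : ∀ k → X^ (k ℕ.+ k ℕ.+ k) ≗ X^ k ⊛ X^ k ⊛ X^ k
  X^-3 k = R.trans (X^-+ (k ℕ.+ k) k) (⊛-cong (X^-+ k k) (R.refl {X^ k}))
  X^-3+ : ∀ k m → X^ (k ℕ.+ k ℕ.+ k ℕ.+ m) ≗ X^ k ⊛ X^ k ⊛ X^ k ⊛ X^ m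
  X^-3+ k m = R.trans (X^-+ (k ℕ.+ k ℕ.+ k) m) (⊛-cong (X^-3 k) (R.refl {X^ m}))
  3[k+d]≡3k+2d+d : ∀ k n → (k ℕ.+ suc n) ℕ.+ (k ℕ.+ suc n) ℕ.+ (k ℕ.+ suc n)
                          ≡ (k ℕ.+ k ℕ.+ k ℕ.+ (suc n ℕ.+ suc n)) ℕ.+ suc n
  3[k+d]≡3k+2d+d = ℕ-solve-∀
  3[k+d]≡1+3k+2+3n : ∀ k n → (k ℕ.+ suc n) ℕ.+ (k ℕ.+ suc n) ℕ.+ (k ℕ.+ suc n)
                            ≡ suc (k ℕ.+ k ℕ.+ k ℕ.+ (2 ℕ.+ (n ℕ.+ n ℕ.+ n)))
  3[k+d]≡1+3k+2+3n = ℕ-solve-∀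
  φ≗ : toSeries T y ≗ Y ⊛ ψ
  φ≗ = R.trans (toSeries-≡ y T≡k+d) (toSeries-+ (proj₂ degree) k)
  τ≗ : toSeries T tL ≗ Y ⊛ X^ n
  τ≗ = R.trans (toSeries-≡ tL (trans T≡k+d (ℕP.+-suc k n))) (R.trans (toSeries-tL (k ℕ.+ n)) (X^-+ k n))
  φ₃≗ : toSeries N y ≗ Y ⊛ Y ⊛ Y ⊛ X^ (d ℕ.+ d) ⊛ ψ
  φ₃≗ = R.trans (toSeries-≡ y (trans (cong (λ t → t ℕ.+ t ℕ.+ t) T≡k+d) (3[k+d]≡3k+2d+d k n)))
        (R.trans (toSeries-+ (proj₂ degree) (k ℕ.+ k ℕ.+ k ℕ.+ (d ℕ.+ d)))
                 (⊛-cong (X^-3+ k (d ℕ.+ d)) (R.refl {ψ})))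
  τ₃≗ : toSeries N tL ≗ Y ⊛ Y ⊛ Y ⊛ X^ (2 ℕ.+ (n ℕ.+ n ℕ.+ n))
  τ₃≗ = R.trans (toSeries-≡ tL (trans (cong (λ t → t ℕ.+ t ℕ.+ t) T≡k+d) (3[k+d]≡1+3k+2+3n k n)))
        (R.trans (toSeries-tL _) (X^-3+ k (2 ℕ.+ (n ℕ.+ n ℕ.+ n))))
  factorisation : ∀ Y ψ A₁ A₂ A₃ →
    Pˢ (Y ⊛ ψ) (Y ⊛ A₁) (Y ⊛ Y ⊛ Y ⊛ A₂ ⊛ ψ) (Y ⊛ Y ⊛ Y ⊛ A₃)
    ≗ Y ⊛ Y ⊛ Y ⊛ (cst (ℕtoℚ 3) ⊛ (ψ ⊛ ψ ⊛ ψ) ⊕ ⊖ (cst (ℕtoℚ 3) ⊛ (A₁ ⊛ ψ ⊛ ψ)) ⊕ ⊖ (cst (ℕtoℚ 9) ⊛ (A₂ ⊛ ψ)) ⊕ A₃)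
  factorisation = solve-series 5 (λ Y ψ A₁ A₂ A₃ →
    ((:cst (ℕtoℚ 3) :⊛ (((Y :⊛ ψ) :⊛ (Y :⊛ ψ)) :⊛ (Y :⊛ ψ))
       :⊕ :cst (- 1ℚ) :⊛ (:cst (ℕtoℚ 3) :⊛ (((Y :⊛ A₁) :⊛ (Y :⊛ ψ)) :⊛ (Y :⊛ ψ))))
       :⊕ :cst (- 1ℚ) :⊛ (:cst (ℕtoℚ 9) :⊛ (Y :⊛ Y :⊛ Y :⊛ A₂ :⊛ ψ))) :⊕ Y :⊛ Y :⊛ Y :⊛ A₃
    :≗ Y :⊛ Y :⊛ Y :⊛ (:cst (ℕtoℚ 3) :⊛ (ψ :⊛ ψ :⊛ ψ) :⊕ :⊖ (:cst (ℕtoℚ 3) :⊛ (A₁ :⊛ ψ :⊛ ψ))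
                        :⊕ :⊖ (:cst (ℕtoℚ 9) :⊛ (A₂ :⊛ ψ)) :⊕ A₃)) R.refl

Cubicᵈ-zero : ∀ ψ → Cubicᵈ 0 ψ ≗ Cubic ψ
Cubicᵈ-zero ψ = solve-series 2 (λ ψ x →
  :cst (ℕtoℚ 3) :⊛ (ψ :⊛ ψ :⊛ ψ) :⊕ :⊖ (:cst (ℕtoℚ 3) :⊛ (:cst 1ℚ :⊛ ψ :⊛ ψ)) :⊕ :⊖ (:cst (ℕtoℚ 9) :⊛ ((x :⊛ (x :⊛ :cst 1ℚ)) :⊛ ψ))
    :⊕ x :⊛ (x :⊛ :cst 1ℚ)
  :≗ :cst (ℕtoℚ 3) :⊛ (ψ :⊛ ψ :⊛ ψ) :⊕ :⊖ (:cst (ℕtoℚ 3) :⊛ (ψ :⊛ ψ)) :⊕ :⊖ (:cst (ℕtoℚ 9) :⊛ (x :⊛ x :⊛ ψ)) :⊕ x :⊛ x)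
  R.refl ψ X

Cubicᵈ-const : ∀ m ψ → Cubicᵈ (suc m) ψ 0 ≡ ℕtoℚ 3 * ((ψ 0 * ψ 0) * ψ 0)
Cubicᵈ-const m ψ = begin
  Cubicᵈ (suc m) ψ 0                                     ≡⟨ expansion 0 ⟩
  ℕtoℚ 3 * ((ψ 0 * ψ 0) * ψ 0) + (X ⊛ rest) 0            ≡⟨ cong (ℕtoℚ 3 * ((ψ 0 * ψ 0) * ψ 0) +_) (X⊛-zero rest) ⟩
  ℕtoℚ 3 * ((ψ 0 * ψ 0) * ψ 0) + 0ℚ                      ≡⟨ ℚP.+-identityʳ _ ⟩
  ℕtoℚ 3 * ((ψ 0 * ψ 0) * ψ 0)                           ∎
  where
  open ≡-Reasoning
  rest = ⊖ (cst (ℕtoℚ 3) ⊛ (X^ m ⊛ ψ ⊛ ψ)) ⊕ ⊖ (cst (ℕtoℚ 9) ⊛ (X^ (suc m ℕ.+ suc (suc m)) ⊛ ψ))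
         ⊕ X^ (suc (suc m ℕ.+ suc m ℕ.+ suc m))
  expansion : Cubicᵈ (suc m) ψ ≗ cst (ℕtoℚ 3) ⊛ (ψ ⊛ ψ ⊛ ψ) ⊕ X ⊛ rest
  expansion = solve-series 5 (λ ψ x B₁ B₂ B₃ →
    :cst (ℕtoℚ 3) :⊛ (ψ :⊛ ψ :⊛ ψ) :⊕ :⊖ (:cst (ℕtoℚ 3) :⊛ ((x :⊛ B₁) :⊛ ψ :⊛ ψ)) :⊕ :⊖ (:cst (ℕtoℚ 9) :⊛ ((x :⊛ B₂) :⊛ ψ)) :⊕ x :⊛ B₃
    :≗ :cst (ℕtoℚ 3) :⊛ (ψ :⊛ ψ :⊛ ψ) :⊕ x :⊛ (:⊖ (:cst (ℕtoℚ 3) :⊛ (B₁ :⊛ ψ :⊛ ψ)) :⊕ :⊖ (:cst (ℕtoℚ 9) :⊛ (B₂ :⊛ ψ)) :⊕ B₃))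
    R.refl ψ X (X^ m) (X^ (suc m ℕ.+ suc (suc m))) (X^ (suc (suc m ℕ.+ suc m ℕ.+ suc m)))

-- The constant term of Cubic ψ is 3a³ − 3a² with a = ψ 0.
Cubic-const≡1 : ∀ {ψ} → Cubic ψ ≗ 𝟘 → ψ 0 ≢ 0ℚ → ψ 0 ≡ 1ℚ
Cubic-const≡1 {ψ} Cubicψ≗0 ψ0≢0 = p-q≡0⇒p≡q (p*q≡0⇒q≡0 3≢0 (p*q≡0⇒q≡0 ψ0≢0 (p*q≡0⇒q≡0 ψ0≢0
  (trans (identity (ψ 0)) (Cubicψ≗0 0)))))
  where
  identity : ∀ a → a * (a * (ℕtoℚ 3 * (a - 1ℚ)))
                   ≡ ℕtoℚ 3 * ((a * a) * a) + - (ℕtoℚ 3 * (a * a)) + - (ℕtoℚ 9 * ((0ℚ * 0ℚ) * a)) + 0ℚ * 0ℚ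
  identity = solve 1 (λ a → a :* (a :* (con (ℕtoℚ 3) :* (a :- con 1ℚ)))
    := con (ℕtoℚ 3) :* ((a :* a) :* a) :+ :- (con (ℕtoℚ 3) :* (a :* a)) :+ :- (con (ℕtoℚ 9) :* ((con 0ℚ :* con 0ℚ) :* a))
       :+ con 0ℚ :* con 0ℚ) refl

P-root-unique : ∀ y → P y ≈ 0L → DegPos y → y ≈ x₀
P-root-unique y Py≈0 (ℤ.+ zero , _ , ℤ.+<+ ())
P-root-unique y Py≈0 (-[1+ _ ] , _ , ())
P-root-unique y Py≈0 (ℤ.+ suc zero , degree , _) =
  toSeries-injective y x₀ T ℕP.≤-refl (degree≤top degree) (begin
    toSeries T y          ≈⟨ toSeries-≡ y T≡k+1 ⟩
    toSeries (k ℕ.+ 1) y  ≈⟨ toSeries-+ (proj₂ degree) k ⟩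
    X^ k ⊛ ψ              ≈⟨ ⊛-cong (R.refl {X^ k}) (f₀-unique ψ Cubicψ≗0 (Cubic-const≡1 Cubicψ≗0 (toSeries-leading≢0 degree))) ⟩
    X^ k ⊛ f₀             ≈⟨ ⊛-cong (R.refl {X^ k}) (R.sym (toSeries-top x₀)) ⟩
    X^ k ⊛ toSeries 1 x₀  ≈⟨ R.sym (toSeries-+ (top-bounded ℕP.≤-refl) k) ⟩
    toSeries (k ℕ.+ 1) x₀ ≈⟨ toSeries-≡ x₀ (sym T≡k+1) ⟩
    toSeries T x₀         ∎)
  where
  open ≗-Reasoning
  T = top y
  k = T ℕ.∸ 1
  T≡k+1 : T ≡ k ℕ.+ 1
  T≡k+1 = sym (ℕP.m∸n+n≡m (degree≤top degree))
  ψ = toSeries 1 y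
  Cubicψ≗0 : Cubic ψ ≗ 𝟘
  Cubicψ≗0 = R.trans (R.sym (Cubicᵈ-zero ψ)) (P-root⇒Cubicᵈ y 0 Py≈0 degree)
P-root-unique y Py≈0 (ℤ.+ suc (suc m) , degree , _) =
  ⊥-elim (p*q≢0 3≢0 (p*q≢0 (p*q≢0 ψ0≢0 ψ0≢0) ψ0≢0)
                (trans (sym (Cubicᵈ-const m ψ)) (P-root⇒Cubicᵈ y (suc m) Py≈0 degree 0)))
  where
  ψ = toSeries (suc (suc m)) y
  ψ0≢0 = toSeries-leading≢0 degree

completeQuotient : ℕ → Laurent
completeQuotient i = mkL 1 (proj₁ (riccatiSolution i))

cf-1L : cf 1L ≗ cst 1ℚ
cf-1L zero    = refl
cf-1L (suc n) = refl

toSeries-aseq : ∀ i → toSeries 1 (aseq i) ≗ cst (Cseq i)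
toSeries-aseq zero    = toSeries-tL 0
toSeries-aseq (suc i) =
  R.trans (toSeries-• 1 (Cseq (suc i)) tL) (R.trans (⊛-cong (R.refl {cst (Cseq (suc i))}) (toSeries-tL 0)) (R.*-identityʳ _))

toSeries-1L : ∀ N → toSeries N 1L ≗ X^ N
toSeries-1L N = R.trans (toSeries≗X^⊛cf 1L N z≤n) (R.trans (⊛-cong (R.refl {X^ N}) cf-1L) (R.*-identityʳ (X^ N)))

top-aseq : ∀ i → top (aseq i) ≡ 1
top-aseq zero    = refl
top-aseq (suc i) = refl

module CompleteQuotient (i : ℕ) where

  open RiccatiStep (riccatiSolution-step i (riccatiSolution i))

  x = completeQuotient i
  z = βseq i • x -L aseq i

  top-z≤1 : top z ℕ.≤ 1
  top-z≤1 = ℕP.⊔-lub ℕP.≤-refl (ℕP.≤-reflexive (top-aseq i))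

  toSeries-z : toSeries 1 z ≗ X ⊛ (X ⊛ remainder)
  toSeries-z = begin
    toSeries 1 z                                              ≈⟨ toSeries-+L 1 (βseq i • x) (-L aseq i) ⟩
    toSeries 1 (βseq i • x) ⊕ toSeries 1 (-L aseq i)
      ≈⟨ R.+-cong (R.trans (toSeries-• 1 (βseq i) x) (⊛-cong (R.refl {cst (βseq i)}) (toSeries-top x)))
                  (R.trans (toSeries-• 1 (- 1ℚ) (aseq i)) (⊛-cong (R.refl {cst (- 1ℚ)}) (toSeries-aseq i))) ⟩
    cst (βseq i) ⊛ proj₁ (riccatiSolution i) ⊕ cst (- 1ℚ) ⊛ cst (Cseq i)
      ≈⟨ R.+-cong split (R.refl {cst (- 1ℚ) ⊛ cst (Cseq i)}) ⟩
    (cst (Cseq i) ⊕ X ⊛ (X ⊛ remainder)) ⊕ cst (- 1ℚ) ⊛ cst (Cseq i)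
      ≈⟨ solve-series 3 (λ c x h → (c :⊕ x :⊛ (x :⊛ h)) :⊕ :cst (- 1ℚ) :⊛ c :≗ x :⊛ (x :⊛ h)) R.refl (cst (Cseq i)) X remainder ⟩
    X ⊛ (X ⊛ remainder)                                       ∎
    where open ≗-Reasoning

  DegNeg-z : DegNeg z
  DegNeg-z = -[1+ 0 ] , (leading , above) , ℤ.-<+
    where
    leading : coeff z -[1+ 0 ] ≢ 0ℚ
    leading eq = remainder-const≢0 (trans (sym (trans (X⊛-suc (X ⊛ remainder) 1) (X⊛-suc remainder 0)))
                                          (trans (sym (toSeries-z 2)) eq))
    above : ∀ e → -[1+ 0 ] ℤ.< e → coeff z e ≡ 0ℚ
    above (ℤ.+ zero)          _ = trans (toSeries-z 1) (trans (X⊛-suc (X ⊛ remainder) 0) (X⊛-zero remainder))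
    above (ℤ.+ suc zero)      _ = trans (toSeries-z 0) (X⊛-zero (X ⊛ remainder))
    above (ℤ.+ suc (suc m)) _   = top-bounded top-z≤1 (ℤ.+ suc (suc m)) (ℤ.+<+ (s≤s (s≤s z≤n)))
    above -[1+ m ] (ℤ.-<- ())

  next-inverse : completeQuotient (suc i) *L z ≈ 1L
  next-inverse = toSeries-injective (completeQuotient (suc i) *L z) 1L 2 (ℕP.+-mono-≤ (ℕP.≤-refl {1}) top-z≤1) z≤n (begin
    toSeries 2 (completeQuotient (suc i) *L z)               ≈⟨ toSeries-*L (completeQuotient (suc i)) z 1 1 ℕP.≤-refl top-z≤1 ⟩
    toSeries 1 (completeQuotient (suc i)) ⊛ toSeries 1 z     ≈⟨ ⊛-cong (toSeries-top (completeQuotient (suc i))) toSeries-z ⟩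
    reciprocal ⊛ (X ⊛ (X ⊛ remainder))                       ≈⟨ solve-series 3 (λ g x h → g :⊛ (x :⊛ (x :⊛ h)) :≗ x :⊛ (x :⊛ (h :⊛ g)))
                                                                             R.refl reciprocal X remainder ⟩
    X ⊛ (X ⊛ (remainder ⊛ reciprocal))                       ≈⟨ ⊛-cong (R.refl {X}) (⊛-cong (R.refl {X}) reciprocal-inverse) ⟩
    X^ 2                                                     ≈⟨ R.sym (toSeries-1L 2) ⟩
    toSeries 2 1L                                            ∎)
    where open ≗-Reasoning

x₀-HasCF : HasCF βseq aseq x₀
x₀-HasCF = completeQuotient , (λ _ → refl) , λ i → CompleteQuotient.DegNeg-z i , CompleteQuotient.next-inverse i

mainTheorem4 : Σ Laurent λ x →
    (P x ≈ 0L) × DegPos x ×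
    (∀ y → P y ≈ 0L → DegPos y → y ≈ x) ×
    HasCF βseq aseq x
mainTheorem4 = x₀ , P-x₀ , DegPos-x₀ , P-root-unique , x₀-HasCF
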